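{- Let $p$ be a prime, $H\cong\mathbb{F}_p^r$ with $r\ge1$, $1\le n<p$, $\Omega=\mathbb{F}_p[H]$ with augmentation ideal $I$, and $H^\vee=\mathrm{Hom}(H,\mathbb{F}_p)$. Then the image of the map $p_{ -,n}\colon H^\vee\to(I^n/I^{n+1})^\vee$, $\chi\mapsto p_{\chi,n}$, generates $(I^n/I^{n+1})^\vee$ as an $\mathbb{F}_p$-vector space.
   Context: $V^\vee=\mathrm{Hom}(V,\mathbb{F}_p)$. For $\chi\in H^\vee$, $\binom{\chi}{n}^{\mathrm{mat}}\colon H\to\mathrm{U}_{n+1}(\mathbb{F}_p)$ sends $h$ to the upper-triangular matrix with $(i,j)$-entry $\binom{\chi(h)}{j-i}$ (a homomorphism since $n<p$). The $\mathbb{F}_p$-linear map $\Omega\to\mathbb{F}_p^{n+1}$ (columns), $[h]\mapsto\binom{\chi(h)}{n}^{\mathrm{mat}}e_{n+1}$ ($e_{n+1}$ the last standard basis vector), factors through $\Omega/I^{n+1}$ and carries $I^n/I^{n+1}$ into the first coordinate; $p_{\chi,n}\in(I^n/I^{n+1})^\vee$ is the induced map to that coordinate. -}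

module Defs where

open import Data.Nat using (ℕ; zero; suc; _+_; _*_; _∸_; _≤_; _≤?_; NonZero)
open import Data.Nat.DivMod using (_mod_)
open import Data.Nat.Combinatorics using (_C_)
open import Data.Fin using (Fin; toℕ; fromℕ)
open import Data.Fin.Base using () renaming (zero to fzero)
open import Data.Vec using (Vec; []; _∷_; zipWith)
open import Data.Vec.Properties using (≡-dec)
import Data.Fin.Properties as FinP
open import Data.List using (List; []; _∷_; concatMap; map; foldr; allFin)
open import Data.Product using (_×_; _,_)
open import Relation.Binary.PropositionalEquality using (_≡_)
open import Relation.Nullary using (yes; no)

-- Everything is parametrised by the characteristic p (assumed nonzero so that
-- arithmetic mod p is available; primality is a hypothesis of the theorem).
module _ (p : ℕ) .{{nz : NonZero p}} where

  Fp : Set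
  Fp = Fin p

  infixl 6 _+F_
  infixl 7 _*F_

  _+F_ : Fp → Fp → Fp
  a +F b = (toℕ a + toℕ b) mod p

  _*F_ : Fp → Fp → Fp
  a *F b = (toℕ a * toℕ b) mod p

  0F : Fp
  0F = 0 mod p

  sumF : List Fp → Fp
  sumF = foldr _+F_ 0F

  H : ℕ → Set
  H r = Vec Fp r

  _+H_ : ∀ {r} → H r → H r → H r
  _+H_ = zipWith _+F_

  allH : (r : ℕ) → List (H r)
  allH zero = [] ∷ []
  allH (suc r) = concatMap (λ a → map (a ∷_) (allH r)) (allFin p)

  sumH : (r : ℕ) → (H r → Fp) → Fp
  sumH r f = sumF (map f (allH r))

  -- The group algebra Ω = F_p[H], elements are functions H → F_p
  -- (x ↦ Σ_h x(h) [h]).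
  Ω : ℕ → Set
  Ω r = H r → Fp

  _≗Ω_ : ∀ {r} → Ω r → Ω r → Set
  x ≗Ω y = ∀ h → x h ≡ y h

  0Ω : ∀ {r} → Ω r
  0Ω _ = 0F

  _+Ω_ : ∀ {r} → Ω r → Ω r → Ω r
  (x +Ω y) h = x h +F y h

  _·Ω_ : ∀ {r} → Fp → Ω r → Ω r
  (c ·Ω x) h = c *F x h

  mulΩ : (r : ℕ) → Ω r → Ω r → Ω r
  mulΩ r x y h = sumH r (λ g → sumH r (λ k → term g k))
    where
      term : H r → H r → Fp
      term g k with ≡-dec FinP._≟_ (g +H k) h
      ... | yes _ = x g *F y k
      ... | no _ = 0F

  aug : (r : ℕ) → Ω r → Fp
  aug r x = sumH r x

  InI : (r : ℕ) → Ω r → Set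
  InI r x = aug r x ≡ 0F

  -- Powers of the augmentation ideal: I^0 = Ω, I^(n+1) = I · I^n
  -- (the F_p-span of products x*y with x ∈ I and y ∈ I^n).
  data InIPow (r : ℕ) : ℕ → Ω r → Set where
    pow-zero : ∀ x → InIPow r 0 x
    pow-gen  : ∀ {n} x y → InI r x → InIPow r n y → InIPow r (suc n) (mulΩ r x y)
    pow-0    : ∀ {n} → InIPow r (suc n) 0Ω
    pow-add  : ∀ {n x y} → InIPow r (suc n) x → InIPow r (suc n) y → InIPow r (suc n) (x +Ω y)
    pow-scal : ∀ {n x} c → InIPow r (suc n) x → InIPow r (suc n) (c ·Ω x)

  record Hom (r : ℕ) : Set where
    field
      fun  : H r → Fp
      hom  : ∀ g h → fun (g +H h) ≡ fun g +F fun h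
  open Hom public

  binomF : Fp → ℕ → Fp
  binomF a k = (toℕ a C k) mod p

  binomMat : (n : ℕ) → Fp → Fin (suc n) → Fin (suc n) → Fp
  binomMat n a i j with toℕ i ≤? toℕ j
  ... | yes _ = binomF a (toℕ j ∸ toℕ i)
  ... | no _ = 0F

  matLastCol : (n : ℕ) → Fp → Fin (suc n) → Fp
  matLastCol n a i = binomMat n a i (fromℕ n)

  -- the F_p-linear map Ω → F_p^{n+1}, [h] ↦ (χ choose n)^mat(h) e_{n+1}
  colMap : (r n : ℕ) → Hom r → Ω r → Fin (suc n) → Fp
  colMap r n χ x i = sumH r (λ h → x h *F matLastCol n (fun χ h) i)

  pχ : (r n : ℕ) → Hom r → Ω r → Fp
  pχ r n χ x = colMap r n χ x fzero

  -- An element of (I^n / I^{n+1})^∨: an F_p-linear functional on I^n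
  -- (respecting equality in Ω) that vanishes on I^{n+1}.
  record DualGraded (r n : ℕ) : Set where
    field
      φ       : Ω r → Fp
      resp    : ∀ {x y} → InIPow r n x → x ≗Ω y → φ x ≡ φ y
      additive : ∀ {x y} → InIPow r n x → InIPow r n y → φ (x +Ω y) ≡ φ x +F φ y
      homog   : ∀ {x} c → InIPow r n x → φ (c ·Ω x) ≡ c *F φ x
      vanish  : ∀ {x} → InIPow r (suc n) x → φ x ≡ 0F
  open DualGraded public

  linComb : (r n : ℕ) → List (Fp × Hom r) → Ω r → Fp
  linComb r n L x = sumF (map (λ { (c , χ) → c *F pχ r n χ x }) L)

-- Write Δ g for multiplication by [g] - 1 in 𝔽ₚ[H]. Modulo Iⁿ⁺¹, Iⁿ is spanned by the monomials
-- Δ h₁ ⋯ Δ hₙ [0], so ψ is determined by Φ(h₁, …, hₙ) = ψ(Δ h₁ ⋯ Δ hₙ [0]), which is symmetric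
-- and additive in each argument since [g + k] - 1 = ([g] - 1) + ([k] - 1) + ([g] - 1)([k] - 1).
-- On the other side p_{χ,n}(x) = Σ_h x(h) C(χ(h), n); by Vandermonde's identity mod p (n < p)
-- it vanishes on Iⁿ⁺¹ and takes the value χ(h₁)⋯χ(hₙ) on the monomial. So it suffices that a
-- symmetric multiadditive form on (𝔽ₚʳ)ⁿ is a linear combination of products χ(h₁)⋯χ(hₙ).
-- This goes by induction on r, splitting off the first coordinate: the arguments equal to
-- u₁ = (1, 0, …, 0) contribute a power tˢ to the product for the extended character
-- h ↦ t h₁ + χ(h₂, …, hᵣ), and the exponents s ≤ n < p are separated by a linear combination
-- over t (which needs the inverses of 1, …, n in 𝔽ₚ).

module Submission where

open import Defs
open import Data.Nat using (ℕ; _≤_; _<_; NonZero)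
open import Data.Nat.Primality using (Prime; euclidsLemma)
open import Data.List using (List)
open import Data.Product using (Σ; _×_)
open import Relation.Binary.PropositionalEquality using (_≡_)

open import Algebra.Bundles using (CommutativeRing; Semiring)
open import Algebra.Structures using (IsCommutativeRing)
import Algebra.Properties.Ring as RingProperties
import Algebra.Properties.CommutativeSemigroup as CommutativeSemigroupProperties
import Algebra.Solver.Ring
import Algebra.Solver.Ring.AlmostCommutativeRing as ACR
import Algebra.Definitions.RawSemiring as RawSemiringDefinitions
open import Data.Nat as ℕ using (zero; suc; z≤n; s≤s)
import Data.Nat.Properties as ℕₚ
open import Data.Nat.Induction using (<-rec)
open import Data.Nat.Combinatorics using (_C_; nCk+nC[k+1]≡[n+1]C[k+1]; nC1≡n; nCn≡1; nCk≡nC[n∸k])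
open import Data.Nat.DivMod using (_mod_; _%_; _/_; m%n<n; m<n⇒m%n≡m; %-distribˡ-+; %-distribˡ-*; m*n%n≡0; m≡m%n+[m/n]*n)
open import Data.Nat.Divisibility using (_∣_; divides; ∣⇒≤)
open import Data.Nat.Coprimality as Coprimality using (coprime-Bézout; prime⇒coprime)
open import Data.Nat.GCD using (module Bézout)
open import Data.Integer as ℤ using (ℤ; -[1+_]; _⊖_)
import Data.Integer.Properties as ℤₚ
open import Data.Sign as Sign using (Sign)
open import Data.Sum using (_⊎_; inj₁; inj₂)
open import Data.Fin as Fin using (Fin; toℕ)
import Data.Fin.Properties as Finₚ
open import Data.Maybe using (Maybe; nothing; just)
open import Data.Product using (_,_; proj₁; proj₂)
open import Relation.Binary.PropositionalEquality using (refl; sym; trans; cong; cong₂; subst; isEquivalence; module ≡-Reasoning)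
open import Relation.Nullary using (Dec; yes; no; ¬_)
open import Data.Empty using (⊥-elim)
open import Data.List as List using ([]; _∷_; _++_; map; concatMap; tabulate; allFin; applyUpTo; upTo; catMaybes)
import Data.List.Properties as Listₚ
open import Data.Vec using ([]; _∷_)
open import Data.Vec.Properties using (≡-dec; ∷-injectiveˡ; ∷-injectiveʳ)
open import Function using (_∘_)

[1+k]*[1+n]C[1+k]≡[1+n]*nCk : ∀ n k → suc k ℕ.* (suc n C suc k) ≡ suc n ℕ.* (n C k)
[1+k]*[1+n]C[1+k]≡[1+n]*nCk zero    zero    = refl
[1+k]*[1+n]C[1+k]≡[1+n]*nCk zero    (suc k) = ℕₚ.*-zeroʳ (suc (suc k))
[1+k]*[1+n]C[1+k]≡[1+n]*nCk (suc n) zero    = trans (ℕₚ.*-identityˡ _) (trans (nC1≡n (suc (suc n))) (sym (ℕₚ.*-identityʳ _)))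
[1+k]*[1+n]C[1+k]≡[1+n]*nCk (suc n) (suc k) = begin
  suc (suc k) ℕ.* (suc (suc n) C suc (suc k))
    ≡⟨ cong (suc (suc k) ℕ.*_) (nCk+nC[k+1]≡[n+1]C[k+1] (suc n) (suc k)) ⟨
  suc (suc k) ℕ.* (suc n C suc k ℕ.+ suc n C suc (suc k))
    ≡⟨ ℕₚ.*-distribˡ-+ (suc (suc k)) (suc n C suc k) _ ⟩
  suc (suc k) ℕ.* (suc n C suc k) ℕ.+ suc (suc k) ℕ.* (suc n C suc (suc k))
    ≡⟨ cong (suc (suc k) ℕ.* (suc n C suc k) ℕ.+_) ([1+k]*[1+n]C[1+k]≡[1+n]*nCk n (suc k)) ⟩
  (suc n C suc k) ℕ.+ suc k ℕ.* (suc n C suc k) ℕ.+ suc n ℕ.* (n C suc k)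
    ≡⟨ cong (λ z → (suc n C suc k) ℕ.+ z ℕ.+ suc n ℕ.* (n C suc k)) ([1+k]*[1+n]C[1+k]≡[1+n]*nCk n k) ⟩
  (suc n C suc k) ℕ.+ suc n ℕ.* (n C k) ℕ.+ suc n ℕ.* (n C suc k)
    ≡⟨ ℕₚ.+-assoc (suc n C suc k) _ _ ⟩
  (suc n C suc k) ℕ.+ (suc n ℕ.* (n C k) ℕ.+ suc n ℕ.* (n C suc k))
    ≡⟨ cong ((suc n C suc k) ℕ.+_) (ℕₚ.*-distribˡ-+ (suc n) (n C k) (n C suc k)) ⟨
  (suc n C suc k) ℕ.+ suc n ℕ.* (n C k ℕ.+ n C suc k)
    ≡⟨ cong (λ z → (suc n C suc k) ℕ.+ suc n ℕ.* z) (nCk+nC[k+1]≡[n+1]C[k+1] n k) ⟩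
  suc (suc n) ℕ.* (suc n C suc k)
    ∎
  where open ≡-Reasoning

prime∣pCk : ∀ {q k} → Prime q → 0 < k → k < q → q ∣ q C k
prime∣pCk {suc n} {suc k} q-prime _ k<q
  with euclidsLemma (suc k) (suc n C suc k) q-prime
         (divides (n C k) (trans ([1+k]*[1+n]C[1+k]≡[1+n]*nCk n k) (ℕₚ.*-comm (suc n) (n C k))))
... | inj₁ q∣1+k = ⊥-elim (ℕₚ.<⇒≱ k<q (∣⇒≤ q∣1+k))
... | inj₂ q∣qCk = q∣qCk

module Theory (p : ℕ) .{{nz : NonZero p}} where

  -- Arithmetic in 𝔽ₚ

  F : Set
  F = Fp p

  infixl 6 _+_ _-_
  infixl 7 _*_
  infix 8 -_

  _+_ : F → F → F
  _+_ = _+F_ p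

  _*_ : F → F → F
  _*_ = _*F_ p

  0# : F
  0# = 0F p

  residue : ℕ → F
  residue m = m mod p

  1# : F
  1# = residue 1

  -_ : F → F
  - a = residue (p ℕ.∸ toℕ a)

  _-_ : F → F → F
  a - b = a + - b

  toℕ-residue : ∀ m → toℕ (residue m) ≡ m % p
  toℕ-residue m = Finₚ.toℕ-fromℕ< (m%n<n m p)

  residue-cong : ∀ {m n} → m % p ≡ n % p → residue m ≡ residue n
  residue-cong {m} {n} eq = Finₚ.toℕ-injective (trans (toℕ-residue m) (trans eq (sym (toℕ-residue n))))

  residue-toℕ : ∀ a → residue (toℕ a) ≡ a
  residue-toℕ a = Finₚ.toℕ-injective (trans (toℕ-residue (toℕ a)) (m<n⇒m%n≡m (Finₚ.toℕ<n a)))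

  residue-+ : ∀ m n → residue (m ℕ.+ n) ≡ residue m + residue n
  residue-+ m n = residue-cong (trans (%-distribˡ-+ m n p)
    (cong₂ (λ u v → (u ℕ.+ v) % p) (sym (toℕ-residue m)) (sym (toℕ-residue n))))

  residue-* : ∀ m n → residue (m ℕ.* n) ≡ residue m * residue n
  residue-* m n = residue-cong (trans (%-distribˡ-* m n p)
    (cong₂ (λ u v → (u ℕ.* v) % p) (sym (toℕ-residue m)) (sym (toℕ-residue n))))

  residue-divisible : ∀ {m} → p ∣ m → residue m ≡ 0#
  residue-divisible (divides q refl) =
    residue-cong (trans (m*n%n≡0 q p) (sym (m<n⇒m%n≡m (ℕ.>-nonZero⁻¹ p))))

  +-comm : ∀ a b → a + b ≡ b + a
  +-comm a b = cong residue (ℕₚ.+-comm (toℕ a) (toℕ b))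

  *-comm : ∀ a b → a * b ≡ b * a
  *-comm a b = cong residue (ℕₚ.*-comm (toℕ a) (toℕ b))

  +-assoc : ∀ a b c → (a + b) + c ≡ a + (b + c)
  +-assoc a b c = begin
    (a + b) + c                                   ≡⟨ cong ((a + b) +_) (sym (residue-toℕ c)) ⟩
    residue (toℕ a ℕ.+ toℕ b) + residue (toℕ c)   ≡⟨ residue-+ (toℕ a ℕ.+ toℕ b) (toℕ c) ⟨
    residue (toℕ a ℕ.+ toℕ b ℕ.+ toℕ c)           ≡⟨ cong residue (ℕₚ.+-assoc (toℕ a) (toℕ b) (toℕ c)) ⟩
    residue (toℕ a ℕ.+ (toℕ b ℕ.+ toℕ c))         ≡⟨ residue-+ (toℕ a) (toℕ b ℕ.+ toℕ c) ⟩
    residue (toℕ a) + (b + c)                     ≡⟨ cong (_+ (b + c)) (residue-toℕ a) ⟩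
    a + (b + c)                                   ∎
    where open ≡-Reasoning

  *-assoc : ∀ a b c → (a * b) * c ≡ a * (b * c)
  *-assoc a b c = begin
    (a * b) * c                                   ≡⟨ cong ((a * b) *_) (sym (residue-toℕ c)) ⟩
    residue (toℕ a ℕ.* toℕ b) * residue (toℕ c)   ≡⟨ residue-* (toℕ a ℕ.* toℕ b) (toℕ c) ⟨
    residue (toℕ a ℕ.* toℕ b ℕ.* toℕ c)           ≡⟨ cong residue (ℕₚ.*-assoc (toℕ a) (toℕ b) (toℕ c)) ⟩
    residue (toℕ a ℕ.* (toℕ b ℕ.* toℕ c))         ≡⟨ residue-* (toℕ a) (toℕ b ℕ.* toℕ c) ⟩
    residue (toℕ a) * (b * c)                     ≡⟨ cong (_* (b * c)) (residue-toℕ a) ⟩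
    a * (b * c)                                   ∎
    where open ≡-Reasoning

  *-distribˡ-+ : ∀ a b c → a * (b + c) ≡ a * b + a * c
  *-distribˡ-+ a b c = begin
    a * (b + c)                                   ≡⟨ cong (_* (b + c)) (sym (residue-toℕ a)) ⟩
    residue (toℕ a) * residue (toℕ b ℕ.+ toℕ c)   ≡⟨ residue-* (toℕ a) (toℕ b ℕ.+ toℕ c) ⟨
    residue (toℕ a ℕ.* (toℕ b ℕ.+ toℕ c))         ≡⟨ cong residue (ℕₚ.*-distribˡ-+ (toℕ a) (toℕ b) (toℕ c)) ⟩
    residue (toℕ a ℕ.* toℕ b ℕ.+ toℕ a ℕ.* toℕ c) ≡⟨ residue-+ (toℕ a ℕ.* toℕ b) (toℕ a ℕ.* toℕ c) ⟩
    a * b + a * c                                 ∎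
    where open ≡-Reasoning

  *-distribʳ-+ : ∀ a b c → (b + c) * a ≡ b * a + c * a
  *-distribʳ-+ a b c = trans (*-comm (b + c) a)
    (trans (*-distribˡ-+ a b c) (cong₂ _+_ (*-comm a b) (*-comm a c)))

  +-identityˡ : ∀ a → 0# + a ≡ a
  +-identityˡ a = begin
    0# + a                      ≡⟨ cong (0# +_) (sym (residue-toℕ a)) ⟩
    residue 0 + residue (toℕ a) ≡⟨ residue-+ 0 (toℕ a) ⟨
    residue (toℕ a)             ≡⟨ residue-toℕ a ⟩
    a                           ∎
    where open ≡-Reasoning

  +-identityʳ : ∀ a → a + 0# ≡ a
  +-identityʳ a = trans (+-comm a 0#) (+-identityˡ a)

  *-identityˡ : ∀ a → 1# * a ≡ a
  *-identityˡ a = begin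
    1# * a                      ≡⟨ cong (1# *_) (sym (residue-toℕ a)) ⟩
    residue 1 * residue (toℕ a) ≡⟨ residue-* 1 (toℕ a) ⟨
    residue (1 ℕ.* toℕ a)       ≡⟨ cong residue (ℕₚ.*-identityˡ (toℕ a)) ⟩
    residue (toℕ a)             ≡⟨ residue-toℕ a ⟩
    a                           ∎
    where open ≡-Reasoning

  *-identityʳ : ∀ a → a * 1# ≡ a
  *-identityʳ a = trans (*-comm a 1#) (*-identityˡ a)

  -‿inverseʳ : ∀ a → a - a ≡ 0#
  -‿inverseʳ a = begin
    a + - a                                 ≡⟨ cong (_+ - a) (sym (residue-toℕ a)) ⟩
    residue (toℕ a) + residue (p ℕ.∸ toℕ a) ≡⟨ residue-+ (toℕ a) (p ℕ.∸ toℕ a) ⟨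
    residue (toℕ a ℕ.+ (p ℕ.∸ toℕ a))       ≡⟨ cong residue (ℕₚ.m+[n∸m]≡n (ℕₚ.<⇒≤ (Finₚ.toℕ<n a))) ⟩
    residue p                               ≡⟨ residue-divisible (divides 1 (sym (ℕₚ.*-identityˡ p))) ⟩
    0#                                      ∎
    where open ≡-Reasoning

  -‿inverseˡ : ∀ a → - a + a ≡ 0#
  -‿inverseˡ a = trans (+-comm (- a) a) (-‿inverseʳ a)

  isCommutativeRing : IsCommutativeRing _≡_ _+_ _*_ -_ 0# 1#
  isCommutativeRing = record
    { isRing = record
      { +-isAbelianGroup = record
        { isGroup = record
          { isMonoid = record
            { isSemigroup = record
              { isMagma = record { isEquivalence = isEquivalence ; ∙-cong = cong₂ _+_ }
              ; assoc = +-assoc }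
            ; identity = +-identityˡ , +-identityʳ }
          ; inverse = -‿inverseˡ , -‿inverseʳ
          ; ⁻¹-cong = cong (λ a → - a) }
        ; comm = +-comm }
      ; *-cong = cong₂ _*_
      ; *-assoc = *-assoc
      ; *-identity = *-identityˡ , *-identityʳ
      ; distrib = *-distribˡ-+ , *-distribʳ-+ }
    ; *-comm = *-comm }

  commutativeRing : CommutativeRing _ _
  commutativeRing = record { isCommutativeRing = isCommutativeRing }

  open CommutativeRing commutativeRing public using (zeroˡ; zeroʳ)
  open RingProperties (CommutativeRing.ring commutativeRing) public
    using (-‿distribˡ-*; -‿+-comm; -‿involutive; -0#≈0#; +-inverseʳ-unique; x+x≈x⇒x≈0)
  open RawSemiringDefinitions (Semiring.rawSemiring (CommutativeRing.semiring commutativeRing)) public using (_^_)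

  open CommutativeSemigroupProperties (CommutativeRing.+-commutativeSemigroup commutativeRing)
    using () renaming (interchange to +-interchange)
  open CommutativeSemigroupProperties (CommutativeRing.*-commutativeSemigroup commutativeRing)
    using () renaming (interchange to *-interchange)

  -- Integer coefficients for the ring solver: with coefficients in F itself the
  -- normalisation would get stuck on `mod p` for variable p.

  signF : Sign → F
  signF Sign.+ = 1#
  signF Sign.- = - 1#

  fromℤ : ℤ → F
  fromℤ (ℤ.+ n)   = residue n
  fromℤ -[1+ n ] = - residue (suc n)

  fromℤ-⊖ : ∀ m n → fromℤ (m ⊖ n) ≡ residue m - residue n
  fromℤ-⊖ zero    zero    = sym (trans (cong (0# +_) -0#≈0#) (+-identityʳ 0#))
  fromℤ-⊖ zero    (suc n) = sym (+-identityˡ _)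
  fromℤ-⊖ (suc m) zero    = sym (trans (cong (residue (suc m) +_) -0#≈0#) (+-identityʳ _))
  fromℤ-⊖ (suc m) (suc n) = begin
    fromℤ (suc m ⊖ suc n)                             ≡⟨ cong fromℤ (ℤₚ.[1+m]⊖[1+n]≡m⊖n m n) ⟩
    fromℤ (m ⊖ n)                                     ≡⟨ fromℤ-⊖ m n ⟩
    residue m - residue n                             ≡⟨ +-identityˡ _ ⟨
    0# + (residue m - residue n)                      ≡⟨ cong (_+ (residue m - residue n)) (-‿inverseʳ 1#) ⟨
    (1# - 1#) + (residue m - residue n)               ≡⟨ +-interchange 1# (- 1#) (residue m) (- residue n) ⟩
    (1# + residue m) + (- 1# - residue n)             ≡⟨ cong₂ _+_ (residue-+ 1 m) (sym (-‿+-comm 1# (residue n))) ⟨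
    residue (suc m) - (1# + residue n)                ≡⟨ cong (λ x → residue (suc m) - x) (residue-+ 1 n) ⟨
    residue (suc m) - residue (suc n)                 ∎
    where open ≡-Reasoning

  fromℤ-+ : ∀ i j → fromℤ (i ℤ.+ j) ≡ fromℤ i + fromℤ j
  fromℤ-+ (ℤ.+ m)   (ℤ.+ n)   = residue-+ m n
  fromℤ-+ (ℤ.+ m)   -[1+ n ] = fromℤ-⊖ m (suc n)
  fromℤ-+ -[1+ m ] (ℤ.+ n)   = trans (fromℤ-⊖ n (suc m)) (+-comm (residue n) _)
  fromℤ-+ -[1+ m ] -[1+ n ] = begin
    - residue (suc (suc (m ℕ.+ n)))        ≡⟨ cong (λ k → - residue (suc k)) (ℕₚ.+-suc m n) ⟨
    - residue (suc m ℕ.+ suc n)            ≡⟨ cong -_ (residue-+ (suc m) (suc n)) ⟩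
    - (residue (suc m) + residue (suc n))  ≡⟨ -‿+-comm (residue (suc m)) (residue (suc n)) ⟨
    - residue (suc m) - residue (suc n)    ∎
    where open ≡-Reasoning

  fromℤ-◃ : ∀ s n → fromℤ (s ℤ.◃ n) ≡ signF s * residue n
  fromℤ-◃ s       zero    = sym (zeroʳ (signF s))
  fromℤ-◃ Sign.+ (suc n) = sym (*-identityˡ _)
  fromℤ-◃ Sign.- (suc n) = sym (trans (sym (-‿distribˡ-* 1# _)) (cong -_ (*-identityˡ _)))

  fromℤ-sign-abs : ∀ i → fromℤ i ≡ signF (ℤ.sign i) * residue ℤ.∣ i ∣
  fromℤ-sign-abs (ℤ.+ n)   = sym (*-identityˡ _)
  fromℤ-sign-abs -[1+ n ] = fromℤ-◃ Sign.- (suc n)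

  signF-* : ∀ s t → signF (s Sign.* t) ≡ signF s * signF t
  signF-* Sign.+ t      = sym (*-identityˡ _)
  signF-* Sign.- Sign.+ = sym (*-identityʳ _)
  signF-* Sign.- Sign.- = sym (trans (sym (-‿distribˡ-* 1# (- 1#)))
                                      (trans (cong -_ (*-identityˡ _)) (-‿involutive 1#)))

  fromℤ-* : ∀ i j → fromℤ (i ℤ.* j) ≡ fromℤ i * fromℤ j
  fromℤ-* i j = begin
    fromℤ (i ℤ.* j)
      ≡⟨ fromℤ-◃ (ℤ.sign i Sign.* ℤ.sign j) _ ⟩
    signF (ℤ.sign i Sign.* ℤ.sign j) * residue (ℤ.∣ i ∣ ℕ.* ℤ.∣ j ∣)
      ≡⟨ cong₂ _*_ (signF-* (ℤ.sign i) (ℤ.sign j)) (residue-* ℤ.∣ i ∣ ℤ.∣ j ∣) ⟩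
    (signF (ℤ.sign i) * signF (ℤ.sign j)) * (residue ℤ.∣ i ∣ * residue ℤ.∣ j ∣)
      ≡⟨ *-interchange (signF (ℤ.sign i)) _ _ _ ⟩
    (signF (ℤ.sign i) * residue ℤ.∣ i ∣) * (signF (ℤ.sign j) * residue ℤ.∣ j ∣)
      ≡⟨ cong₂ _*_ (fromℤ-sign-abs i) (fromℤ-sign-abs j) ⟨
    fromℤ i * fromℤ j
      ∎
    where open ≡-Reasoning

  fromℤ-neg : ∀ i → fromℤ (ℤ.- i) ≡ - fromℤ i
  fromℤ-neg (ℤ.+ zero)  = sym -0#≈0#
  fromℤ-neg (ℤ.+ suc n) = refl
  fromℤ-neg -[1+ n ]   = sym (-‿involutive _)

  ℤ⟶F : ℤ.+-*-rawRing ACR.-Raw-AlmostCommutative⟶ ACR.fromCommutativeRing commutativeRing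
  ℤ⟶F = record
    { ⟦_⟧ = fromℤ ; +-homo = fromℤ-+ ; *-homo = fromℤ-* ; -‿homo = fromℤ-neg ; 0-homo = refl ; 1-homo = refl }

  fromℤ-≟ : ∀ i j → Maybe (fromℤ i ≡ fromℤ j)
  fromℤ-≟ i j with i ℤₚ.≟ j
  ... | yes i≡j = just (cong fromℤ i≡j)
  ... | no _    = nothing

  open Algebra.Solver.Ring ℤ.+-*-rawRing (ACR.fromCommutativeRing commutativeRing) ℤ⟶F fromℤ-≟
    using (solve; _:+_; _:*_; _:-_; :-_; _:=_; con)

  -- Finite sums

  select : ∀ {A : Set} → Dec A → F → F
  select (yes _) v = v
  select (no _)  v = 0#

  select-yes : ∀ {A : Set} (d : Dec A) {v} → A → select d v ≡ v
  select-yes (yes _) a = refl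
  select-yes (no ¬a) a = ⊥-elim (¬a a)

  select-no : ∀ {A : Set} (d : Dec A) {v} → ¬ A → select d v ≡ 0#
  select-no (yes a) ¬a = ⊥-elim (¬a a)
  select-no (no _)  ¬a = refl

  select-⇔ : ∀ {A B : Set} (d : Dec A) (d′ : Dec B) {v} → (A → B) → (B → A) → select d v ≡ select d′ v
  select-⇔ (yes a) d′ f g = sym (select-yes d′ (f a))
  select-⇔ (no ¬a) d′ f g = sym (select-no d′ (λ b → ¬a (g b)))

  select-*ˡ : ∀ {A : Set} (d : Dec A) c v → c * select d v ≡ select d (c * v)
  select-*ˡ (yes _) c v = refl
  select-*ˡ (no _)  c v = zeroʳ c

  select-1-* : ∀ {A : Set} (d : Dec A) v → select d 1# * v ≡ select d v
  select-1-* (yes _) v = *-identityˡ v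
  select-1-* (no _)  v = zeroˡ v

  ∑ : ∀ {A : Set} → List A → (A → F) → F
  ∑ xs f = sumF p (map f xs)

  ∑-cong : ∀ {A : Set} (xs : List A) {f g : A → F} → (∀ x → f x ≡ g x) → ∑ xs f ≡ ∑ xs g
  ∑-cong []       eq = refl
  ∑-cong (x ∷ xs) eq = cong₂ _+_ (eq x) (∑-cong xs eq)

  ∑-zero : ∀ {A : Set} (xs : List A) {f : A → F} → (∀ x → f x ≡ 0#) → ∑ xs f ≡ 0#
  ∑-zero []       eq = refl
  ∑-zero (x ∷ xs) eq = trans (cong₂ _+_ (eq x) (∑-zero xs eq)) (+-identityʳ 0#)

  ∑-+ : ∀ {A : Set} (xs : List A) (f g : A → F) → ∑ xs (λ x → f x + g x) ≡ ∑ xs f + ∑ xs g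
  ∑-+ []       f g = sym (+-identityʳ 0#)
  ∑-+ (x ∷ xs) f g = trans (cong (f x + g x +_) (∑-+ xs f g)) (+-interchange (f x) (g x) (∑ xs f) (∑ xs g))

  ∑-*ˡ : ∀ {A : Set} (xs : List A) c (f : A → F) → ∑ xs (λ x → c * f x) ≡ c * ∑ xs f
  ∑-*ˡ []       c f = sym (zeroʳ c)
  ∑-*ˡ (x ∷ xs) c f = trans (cong (c * f x +_) (∑-*ˡ xs c f)) (sym (*-distribˡ-+ c (f x) (∑ xs f)))

  ∑-*ʳ : ∀ {A : Set} (xs : List A) c (f : A → F) → ∑ xs (λ x → f x * c) ≡ ∑ xs f * c
  ∑-*ʳ xs c f = trans (∑-cong xs (λ x → *-comm (f x) c)) (trans (∑-*ˡ xs c f) (*-comm c _))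

  ∑-neg : ∀ {A : Set} (xs : List A) (f : A → F) → ∑ xs (λ x → - f x) ≡ - ∑ xs f
  ∑-neg []       f = sym -0#≈0#
  ∑-neg (x ∷ xs) f = trans (cong (- f x +_) (∑-neg xs f)) (-‿+-comm (f x) (∑ xs f))

  ∑-++ : ∀ {A : Set} (xs ys : List A) (f : A → F) → ∑ (xs ++ ys) f ≡ ∑ xs f + ∑ ys f
  ∑-++ []       ys f = sym (+-identityˡ _)
  ∑-++ (x ∷ xs) ys f = trans (cong (f x +_) (∑-++ xs ys f)) (sym (+-assoc (f x) (∑ xs f) (∑ ys f)))

  ∑-map : ∀ {A B : Set} (xs : List A) (k : A → B) (f : B → F) → ∑ (map k xs) f ≡ ∑ xs (f ∘ k)
  ∑-map []       k f = refl
  ∑-map (x ∷ xs) k f = cong (f (k x) +_) (∑-map xs k f)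

  ∑-concatMap : ∀ {A B : Set} (xs : List A) (k : A → List B) (f : B → F) →
                ∑ (concatMap k xs) f ≡ ∑ xs (λ a → ∑ (k a) f)
  ∑-concatMap []       k f = refl
  ∑-concatMap (x ∷ xs) k f = trans (∑-++ (k x) (concatMap k xs) f) (cong (∑ (k x) f +_) (∑-concatMap xs k f))

  ∑-comm : ∀ {A B : Set} (xs : List A) (ys : List B) (f : A → B → F) →
           ∑ xs (λ a → ∑ ys (f a)) ≡ ∑ ys (λ b → ∑ xs (λ a → f a b))
  ∑-comm []       ys f = sym (∑-zero ys (λ _ → refl))
  ∑-comm (x ∷ xs) ys f = trans (cong (∑ ys (f x) +_) (∑-comm xs ys f)) (sym (∑-+ ys (f x) _))

  ∑-tabulate : ∀ {A : Set} m (h : Fin m → A) (f : A → F) → ∑ (tabulate h) f ≡ ∑ (allFin m) (f ∘ h)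
  ∑-tabulate m h f = cong (sumF p) (trans (Listₚ.map-tabulate h f) (sym (Listₚ.map-tabulate (λ i → i) (f ∘ h))))

  ∑-δ-Fin : ∀ m (j : Fin m) (v : Fin m → F) → ∑ (allFin m) (λ i → select (i Finₚ.≟ j) (v i)) ≡ v j
  ∑-δ-Fin (suc m) Fin.zero v = begin
    select (Fin.zero {m} Finₚ.≟ Fin.zero) (v Fin.zero) + ∑ (tabulate Fin.suc) (λ i → select (i Finₚ.≟ Fin.zero) (v i))
      ≡⟨ cong₂ _+_ refl (trans (∑-tabulate m Fin.suc _) (∑-zero (allFin m) (λ i → select-no (Fin.suc i Finₚ.≟ Fin.zero {m}) {v (Fin.suc i)} λ ()))) ⟩
    v Fin.zero + 0#
      ≡⟨ +-identityʳ (v Fin.zero) ⟩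
    v Fin.zero
      ∎
    where open ≡-Reasoning
  ∑-δ-Fin (suc m) (Fin.suc j) v = begin
    select (Fin.zero {m} Finₚ.≟ Fin.suc j) (v Fin.zero) + ∑ (tabulate Fin.suc) (λ i → select (i Finₚ.≟ Fin.suc j) (v i))
      ≡⟨ cong₂ _+_ refl (∑-tabulate m Fin.suc _) ⟩
    0# + ∑ (allFin m) (λ i → select (Fin.suc i Finₚ.≟ Fin.suc j) (v (Fin.suc i)))
      ≡⟨ +-identityˡ _ ⟩
    ∑ (allFin m) (λ i → select (Fin.suc i Finₚ.≟ Fin.suc j) (v (Fin.suc i)))
      ≡⟨ ∑-cong (allFin m) (λ i → select-⇔ (Fin.suc i Finₚ.≟ Fin.suc j) (i Finₚ.≟ j) Finₚ.suc-injective (cong Fin.suc)) ⟩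
    ∑ (allFin m) (λ i → select (i Finₚ.≟ j) (v (Fin.suc i)))
      ≡⟨ ∑-δ-Fin m j (v ∘ Fin.suc) ⟩
    v (Fin.suc j)
      ∎
    where open ≡-Reasoning

  ∑< : ℕ → (ℕ → F) → F
  ∑< zero    f = 0#
  ∑< (suc m) f = f 0 + ∑< m (f ∘ suc)

  ∑<-cong : ∀ m {f g : ℕ → F} → (∀ j → j < m → f j ≡ g j) → ∑< m f ≡ ∑< m g
  ∑<-cong zero    eq = refl
  ∑<-cong (suc m) eq = cong₂ _+_ (eq 0 (s≤s z≤n)) (∑<-cong m (λ j j<m → eq (suc j) (s≤s j<m)))

  ∑<-zero : ∀ m {f : ℕ → F} → (∀ j → j < m → f j ≡ 0#) → ∑< m f ≡ 0#
  ∑<-zero zero    eq = refl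
  ∑<-zero (suc m) eq = trans (cong₂ _+_ (eq 0 (s≤s z≤n)) (∑<-zero m (λ j j<m → eq (suc j) (s≤s j<m)))) (+-identityʳ 0#)

  ∑<-+ : ∀ m (f g : ℕ → F) → ∑< m (λ j → f j + g j) ≡ ∑< m f + ∑< m g
  ∑<-+ zero    f g = sym (+-identityʳ 0#)
  ∑<-+ (suc m) f g = trans (cong (f 0 + g 0 +_) (∑<-+ m (f ∘ suc) (g ∘ suc)))
                           (+-interchange (f 0) (g 0) (∑< m (f ∘ suc)) (∑< m (g ∘ suc)))

  ∑<-*ˡ : ∀ m c (f : ℕ → F) → ∑< m (λ j → c * f j) ≡ c * ∑< m f
  ∑<-*ˡ zero    c f = sym (zeroʳ c)
  ∑<-*ˡ (suc m) c f = trans (cong (c * f 0 +_) (∑<-*ˡ m c (f ∘ suc))) (sym (*-distribˡ-+ c (f 0) (∑< m (f ∘ suc))))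

  ∑<-last : ∀ m (f : ℕ → F) → ∑< (suc m) f ≡ ∑< m f + f m
  ∑<-last zero    f = trans (+-identityʳ (f 0)) (sym (+-identityˡ (f 0)))
  ∑<-last (suc m) f = trans (cong (f 0 +_) (∑<-last m (f ∘ suc))) (sym (+-assoc (f 0) (∑< m (f ∘ suc)) (f (suc m))))

  ∑-∑<-comm : ∀ {A : Set} (xs : List A) m (f : A → ℕ → F) → ∑ xs (λ a → ∑< m (f a)) ≡ ∑< m (λ j → ∑ xs (λ a → f a j))
  ∑-∑<-comm xs zero    f = ∑-zero xs (λ _ → refl)
  ∑-∑<-comm xs (suc m) f = trans (∑-+ xs (λ a → f a 0) (λ a → ∑< m (f a ∘ suc)))
                                 (cong (∑ xs (λ a → f a 0) +_) (∑-∑<-comm xs m (λ a → f a ∘ suc)))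

  ∑<-δ : ∀ m c (v : ℕ → F) → c < m → ∑< m (λ j → select (j ℕ.≟ c) (v j)) ≡ v c
  ∑<-δ (suc m) zero v _ = trans
    (cong₂ _+_ refl (∑<-zero m (λ j _ → select-no (suc j ℕ.≟ 0) {v (suc j)} (λ ()))))
    (+-identityʳ (v 0))
  ∑<-δ (suc m) (suc c) v (s≤s c<m) = trans
    (cong₂ _+_ refl (trans (∑<-cong m (λ j _ → select-⇔ (suc j ℕ.≟ suc c) (j ℕ.≟ c) ℕₚ.suc-injective (cong suc)))
                           (∑<-δ m c (v ∘ suc) c<m)))
    (+-identityˡ (v (suc c)))

  ∑<-δ-beyond : ∀ m c (v : ℕ → F) → m ≤ c → ∑< m (λ j → select (j ℕ.≟ c) (v j)) ≡ 0#
  ∑<-δ-beyond m c v m≤c = ∑<-zero m (λ j j<m → select-no (j ℕ.≟ c) {v j} (λ { refl → ℕₚ.<⇒≱ j<m m≤c }))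

  ∑-applyUpTo : ∀ m (g : ℕ → ℕ) (f : ℕ → F) → ∑ (applyUpTo g m) f ≡ ∑< m (f ∘ g)
  ∑-applyUpTo zero    g f = refl
  ∑-applyUpTo (suc m) g f = cong (f (g 0) +_) (∑-applyUpTo m (g ∘ suc) f)

  infixl 6 _⊞_ _⊟_

  _⊞_ : ∀ {r} → H p r → H p r → H p r
  _⊞_ = _+H_ p

  0ᴴ : ∀ {r} → H p r
  0ᴴ {zero}  = []
  0ᴴ {suc r} = 0# ∷ 0ᴴ

  _⊟_ : ∀ {r} → H p r → H p r → H p r
  []      ⊟ []      = []
  (a ∷ g) ⊟ (b ∷ h) = (a - b) ∷ (g ⊟ h)

  ⊞-comm : ∀ {r} (g h : H p r) → g ⊞ h ≡ h ⊞ g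
  ⊞-comm []      []      = refl
  ⊞-comm (a ∷ g) (b ∷ h) = cong₂ _∷_ (+-comm a b) (⊞-comm g h)

  ⊞-identityʳ : ∀ {r} (g : H p r) → g ⊞ 0ᴴ ≡ g
  ⊞-identityʳ []      = refl
  ⊞-identityʳ (a ∷ g) = cong₂ _∷_ (+-identityʳ a) (⊞-identityʳ g)

  ⊞-identityˡ : ∀ {r} (g : H p r) → 0ᴴ ⊞ g ≡ g
  ⊞-identityˡ g = trans (⊞-comm 0ᴴ g) (⊞-identityʳ g)

  ⊞≡⇒≡⊟ : ∀ {r} (g k h : H p r) → g ⊞ k ≡ h → k ≡ h ⊟ g
  ⊞≡⇒≡⊟ []      []      []      eq = refl
  ⊞≡⇒≡⊟ (a ∷ g) (b ∷ k) (c ∷ h) eq = cong₂ _∷_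
    (trans (solve 2 (λ a b → b := (a :+ b) :- a) refl a b) (cong (_- a) (∷-injectiveˡ eq)))
    (⊞≡⇒≡⊟ g k h (∷-injectiveʳ eq))

  ≡⊟⇒⊞≡ : ∀ {r} (g k h : H p r) → k ≡ h ⊟ g → g ⊞ k ≡ h
  ≡⊟⇒⊞≡ []      []      []      eq = refl
  ≡⊟⇒⊞≡ (a ∷ g) (b ∷ k) (c ∷ h) eq = cong₂ _∷_
    (trans (cong (a +_) (∷-injectiveˡ eq)) (solve 2 (λ a c → a :+ (c :- a) := c) refl a c))
    (≡⊟⇒⊞≡ g k h (∷-injectiveʳ eq))

  ⊟-identityʳ : ∀ {r} (h : H p r) → h ⊟ 0ᴴ ≡ h
  ⊟-identityʳ []      = refl
  ⊟-identityʳ (a ∷ h) = cong₂ _∷_ (trans (cong (a +_) -0#≈0#) (+-identityʳ a)) (⊟-identityʳ h)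

  ⊟-⊞ : ∀ {r} (h g k : H p r) → h ⊟ (g ⊞ k) ≡ (h ⊟ g) ⊟ k
  ⊟-⊞ []      []      []      = refl
  ⊟-⊞ (c ∷ h) (a ∷ g) (b ∷ k) =
    cong₂ _∷_ (solve 3 (λ a b c → c :- (a :+ b) := (c :- a) :- b) refl a b c) (⊟-⊞ h g k)

  ⊟-⊟-comm : ∀ {r} (h g k : H p r) → (h ⊟ g) ⊟ k ≡ (h ⊟ k) ⊟ g
  ⊟-⊟-comm []      []      []      = refl
  ⊟-⊟-comm (c ∷ h) (a ∷ g) (b ∷ k) =
    cong₂ _∷_ (solve 3 (λ a b c → (c :- a) :- b := (c :- b) :- a) refl a b c) (⊟-⊟-comm h g k)

  _≟ᴴ_ : ∀ {r} (g h : H p r) → Dec (g ≡ h)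
  _≟ᴴ_ = ≡-dec Finₚ._≟_

  ∑H : ∀ r → (H p r → F) → F
  ∑H = sumH p

  ∑H-suc : ∀ r (f : H p (suc r) → F) → ∑H (suc r) f ≡ ∑ (allFin p) (λ a → ∑H r (λ h → f (a ∷ h)))
  ∑H-suc r f = trans (∑-concatMap (allFin p) (λ a → map (a ∷_) (allH p r)) f)
                     (∑-cong (allFin p) (λ a → ∑-map (allH p r) (a ∷_) f))

  ∑H-δ : ∀ r (g : H p r) (v : H p r → F) → ∑H r (λ h → select (h ≟ᴴ g) (v h)) ≡ v g
  ∑H-δ zero    []      v = +-identityʳ _
  ∑H-δ (suc r) (b ∷ g) v = begin
    ∑H (suc r) (λ h → select (h ≟ᴴ (b ∷ g)) (v h))
      ≡⟨ ∑H-suc r _ ⟩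
    ∑ (allFin p) (λ a → ∑H r (λ h → select ((a ∷ h) ≟ᴴ (b ∷ g)) (v (a ∷ h))))
      ≡⟨ ∑-cong (allFin p) (λ a → column a (a Finₚ.≟ b)) ⟩
    ∑ (allFin p) (λ a → select (a Finₚ.≟ b) (v (a ∷ g)))
      ≡⟨ ∑-δ-Fin p b (λ a → v (a ∷ g)) ⟩
    v (b ∷ g)
      ∎
    where
    open ≡-Reasoning
    column : ∀ a (d : Dec (a ≡ b)) → ∑H r (λ h → select ((a ∷ h) ≟ᴴ (b ∷ g)) (v (a ∷ h))) ≡ select d (v (a ∷ g))
    column a (yes refl) = trans
      (∑-cong (allH p r) (λ h → select-⇔ ((a ∷ h) ≟ᴴ (a ∷ g)) (h ≟ᴴ g) ∷-injectiveʳ (cong (a ∷_))))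
      (∑H-δ r g (λ h → v (a ∷ h)))
    column a (no a≢b) = ∑-zero (allH p r) (λ h → select-no ((a ∷ h) ≟ᴴ (b ∷ g)) (λ eq → a≢b (∷-injectiveˡ eq)))


  -- The group algebra and the difference operators Δ g = ([g] - 1) ⋆_

  infixl 6 _⊕_
  infixl 7 _·_ _⋆_
  infix 4 _≗_ _∈I^_

  _⊕_ : ∀ {r} → Ω p r → Ω p r → Ω p r
  _⊕_ = _+Ω_ p

  _·_ : ∀ {r} → F → Ω p r → Ω p r
  _·_ = _·Ω_ p

  0ᴼ : ∀ {r} → Ω p r
  0ᴼ = 0Ω p

  _≗_ : ∀ {r} → Ω p r → Ω p r → Set
  _≗_ = _≗Ω_ p

  _⋆_ : ∀ {r} → Ω p r → Ω p r → Ω p r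
  x ⋆ y = mulΩ p _ x y

  _∈I^_ : ∀ {r} → Ω p r → ℕ → Set
  x ∈I^ k = InIPow p _ k x

  [_] : ∀ {r} → H p r → Ω p r
  [ g ] h = select (h ≟ᴴ g) 1#

  [_]-1 : ∀ {r} → H p r → Ω p r
  [ g ]-1 h = [ g ] h - [ 0ᴴ ] h

  -- The summand of `mulΩ` is a local `with`-function that cannot be named; the mutual block lets
  -- the type of `⋆-summand` be inferred from its use.
  mutual
    ⋆-unfold : ∀ {r} (x y : Ω p r) h → (x ⋆ y) h ≡ ∑H r (λ g → ∑H r (λ k → select ((g ⊞ k) ≟ᴴ h) (x g * y k)))
    ⋆-unfold {r} x y h = ∑-cong (allH p r) (λ g → ∑-cong (allH p r) (λ k → ⋆-summand x y h g k))

    ⋆-summand : ∀ {r} (x y : Ω p r) h g k → _ ≡ select ((g ⊞ k) ≟ᴴ h) (x g * y k)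
    ⋆-summand x y h g k with (g ⊞ k) ≟ᴴ h
    ... | yes _ = refl
    ... | no _  = refl

  ⋆-convolution : ∀ {r} (x y : Ω p r) h → (x ⋆ y) h ≡ ∑H r (λ g → x g * y (h ⊟ g))
  ⋆-convolution {r} x y h = trans (⋆-unfold x y h) (∑-cong (allH p r) (λ g → trans
    (∑-cong (allH p r) (λ k → select-⇔ ((g ⊞ k) ≟ᴴ h) (k ≟ᴴ (h ⊟ g)) (⊞≡⇒≡⊟ g k h) (≡⊟⇒⊞≡ g k h)))
    (∑H-δ r (h ⊟ g) (λ k → x g * y k))))

  ∑H-[]-* : ∀ r (g : H p r) (f : H p r → F) → ∑H r (λ k → [ g ] k * f k) ≡ f g
  ∑H-[]-* r g f = trans (∑-cong (allH p r) (λ k → select-1-* (k ≟ᴴ g) (f k))) (∑H-δ r g f)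

  aug-[] : ∀ r (g : H p r) → aug p r [ g ] ≡ 1#
  aug-[] r g = ∑H-δ r g (λ _ → 1#)

  []-1∈I : ∀ r (g : H p r) → InI p r [ g ]-1
  []-1∈I r g = begin
    ∑H r (λ h → [ g ] h - [ 0ᴴ ] h)          ≡⟨ ∑-+ (allH p r) [ g ] (λ h → - [ 0ᴴ ] h) ⟩
    ∑H r [ g ] + ∑H r (λ h → - [ 0ᴴ ] h)    ≡⟨ cong₂ _+_ (aug-[] r g) (trans (∑-neg (allH p r) [ 0ᴴ ]) (cong -_ (aug-[] r 0ᴴ))) ⟩
    1# - 1#                                 ≡⟨ -‿inverseʳ 1# ⟩
    0#                                      ∎
    where open ≡-Reasoning

  ⋆-[0] : ∀ {r} (a : Ω p r) h → (a ⋆ [ 0ᴴ ]) h ≡ a h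
  ⋆-[0] {r} a h = begin
    (a ⋆ [ 0ᴴ ]) h                                    ≡⟨ ⋆-convolution a [ 0ᴴ ] h ⟩
    ∑H r (λ g → a g * select ((h ⊟ g) ≟ᴴ 0ᴴ) 1#)      ≡⟨ ∑-cong (allH p r) (λ g → trans (*-comm (a g) _) (select-1-* ((h ⊟ g) ≟ᴴ 0ᴴ) (a g))) ⟩
    ∑H r (λ g → select ((h ⊟ g) ≟ᴴ 0ᴴ) (a g))         ≡⟨ ∑-cong (allH p r) (λ g → select-⇔ ((h ⊟ g) ≟ᴴ 0ᴴ) (g ≟ᴴ h) (⊟≡0⇒≡ g) (≡⇒⊟≡0 g)) ⟩
    ∑H r (λ g → select (g ≟ᴴ h) (a g))                ≡⟨ ∑H-δ r h a ⟩
    a h                                               ∎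
    where
    open ≡-Reasoning
    ⊟≡0⇒≡ : ∀ g → h ⊟ g ≡ 0ᴴ → g ≡ h
    ⊟≡0⇒≡ g eq = trans (sym (⊞-identityʳ g)) (≡⊟⇒⊞≡ g 0ᴴ h (sym eq))
    ≡⇒⊟≡0 : ∀ g → g ≡ h → h ⊟ g ≡ 0ᴴ
    ≡⇒⊟≡0 g eq = sym (⊞≡⇒≡⊟ g 0ᴴ h (trans (⊞-identityʳ g) eq))

  ∑H-translate : ∀ r (g : H p r) (y f : H p r → F) →
                 ∑H r (λ h → y (h ⊟ g) * f h) ≡ ∑H r (λ k → y k * f (k ⊞ g))
  ∑H-translate r g y f = begin
    ∑H r (λ h → y (h ⊟ g) * f h)
      ≡⟨ ∑-cong (allH p r) (λ h → sym (∑H-δ r (h ⊟ g) (λ k → y k * f h))) ⟩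
    ∑H r (λ h → ∑H r (λ k → select (k ≟ᴴ (h ⊟ g)) (y k * f h)))
      ≡⟨ ∑-comm (allH p r) (allH p r) _ ⟩
    ∑H r (λ k → ∑H r (λ h → select (k ≟ᴴ (h ⊟ g)) (y k * f h)))
      ≡⟨ ∑-cong (allH p r) (λ k → ∑-cong (allH p r) (λ h → select-⇔ (k ≟ᴴ (h ⊟ g)) (h ≟ᴴ (k ⊞ g)) (to k h) (from k h))) ⟩
    ∑H r (λ k → ∑H r (λ h → select (h ≟ᴴ (k ⊞ g)) (y k * f h)))
      ≡⟨ ∑-cong (allH p r) (λ k → ∑H-δ r (k ⊞ g) (λ h → y k * f h)) ⟩
    ∑H r (λ k → y k * f (k ⊞ g))
      ∎
    where
    open ≡-Reasoning
    to : ∀ k h → k ≡ h ⊟ g → h ≡ k ⊞ g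
    to k h eq = trans (sym (≡⊟⇒⊞≡ g k h eq)) (⊞-comm g k)
    from : ∀ k h → h ≡ k ⊞ g → k ≡ h ⊟ g
    from k h eq = ⊞≡⇒≡⊟ g k h (trans (⊞-comm g k) (sym eq))

  Δ : ∀ {r} → H p r → Ω p r → Ω p r
  Δ g y = [ g ]-1 ⋆ y

  Δ-apply : ∀ {r} (g : H p r) y h → Δ g y h ≡ y (h ⊟ g) - y h
  Δ-apply {r} g y h = begin
    Δ g y h
      ≡⟨ ⋆-convolution [ g ]-1 y h ⟩
    ∑H r (λ k → ([ g ] k - [ 0ᴴ ] k) * y (h ⊟ k))
      ≡⟨ ∑-cong (allH p r) (λ k → solve 3 (λ a b c → (a :- b) :* c := a :* c :+ (:- (b :* c))) refl ([ g ] k) ([ 0ᴴ ] k) (y (h ⊟ k))) ⟩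
    ∑H r (λ k → [ g ] k * y (h ⊟ k) - [ 0ᴴ ] k * y (h ⊟ k))
      ≡⟨ ∑-+ (allH p r) _ _ ⟩
    ∑H r (λ k → [ g ] k * y (h ⊟ k)) + ∑H r (λ k → - ([ 0ᴴ ] k * y (h ⊟ k)))
      ≡⟨ cong₂ _+_ (∑H-[]-* r g (λ k → y (h ⊟ k))) (trans (∑-neg (allH p r) _) (cong -_ (∑H-[]-* r 0ᴴ (λ k → y (h ⊟ k))))) ⟩
    y (h ⊟ g) - y (h ⊟ 0ᴴ)
      ≡⟨ cong (λ k → y (h ⊟ g) - y k) (⊟-identityʳ h) ⟩
    y (h ⊟ g) - y h
      ∎
    where open ≡-Reasoning

  ⋆-∑Δ : ∀ {r} (a y : Ω p r) h → InI p r a → (a ⋆ y) h ≡ ∑H r (λ g → a g * Δ g y h)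
  ⋆-∑Δ {r} a y h a∈I = sym (begin
    ∑H r (λ g → a g * Δ g y h)
      ≡⟨ ∑-cong (allH p r) (λ g → cong (a g *_) (Δ-apply g y h)) ⟩
    ∑H r (λ g → a g * (y (h ⊟ g) - y h))
      ≡⟨ ∑-cong (allH p r) (λ g → solve 3 (λ a b c → a :* (b :- c) := a :* b :+ (:- (a :* c))) refl (a g) (y (h ⊟ g)) (y h)) ⟩
    ∑H r (λ g → a g * y (h ⊟ g) - a g * y h)
      ≡⟨ ∑-+ (allH p r) _ _ ⟩
    ∑H r (λ g → a g * y (h ⊟ g)) + ∑H r (λ g → - (a g * y h))
      ≡⟨ cong (∑H r (λ g → a g * y (h ⊟ g)) +_) (trans (∑-neg (allH p r) _) (cong -_ (trans (∑-*ʳ (allH p r) (y h) a) (trans (cong (_* y h) a∈I) (zeroˡ (y h)))))) ⟩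
    ∑H r (λ g → a g * y (h ⊟ g)) - 0#
      ≡⟨ trans (cong (∑H r (λ g → a g * y (h ⊟ g)) +_) -0#≈0#) (+-identityʳ _) ⟩
    ∑H r (λ g → a g * y (h ⊟ g))
      ≡⟨ ⋆-convolution a y h ⟨
    (a ⋆ y) h
      ∎)
    where open ≡-Reasoning

  Δ-⊕ : ∀ {r} (g : H p r) x y h → Δ g (x ⊕ y) h ≡ Δ g x h + Δ g y h
  Δ-⊕ g x y h = trans (Δ-apply g (x ⊕ y) h) (trans
    (solve 4 (λ a b c d → (a :+ b) :- (c :+ d) := (a :- c) :+ (b :- d)) refl (x (h ⊟ g)) (y (h ⊟ g)) (x h) (y h))
    (sym (cong₂ _+_ (Δ-apply g x h) (Δ-apply g y h))))

  Δ-· : ∀ {r} (g : H p r) c x h → Δ g (c · x) h ≡ c * Δ g x h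
  Δ-· g c x h = trans (Δ-apply g (c · x) h) (trans
    (solve 3 (λ c a b → c :* a :- c :* b := c :* (a :- b)) refl c (x (h ⊟ g)) (x h))
    (sym (cong (c *_) (Δ-apply g x h))))

  Δ-0 : ∀ {r} (g : H p r) h → Δ g 0ᴼ h ≡ 0#
  Δ-0 g h = trans (Δ-apply g 0ᴼ h) (-‿inverseʳ 0#)

  Δ-cong : ∀ {r} (g : H p r) {x y} → x ≗ y → Δ g x ≗ Δ g y
  Δ-cong g {x} {y} eq h = trans (Δ-apply g x h) (trans (cong₂ _-_ (eq (h ⊟ g)) (eq h)) (sym (Δ-apply g y h)))

  Δ-Δ : ∀ {r} (g k : H p r) z h → Δ g (Δ k z) h ≡ (z ((h ⊟ g) ⊟ k) - z (h ⊟ g)) - (z (h ⊟ k) - z h)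
  Δ-Δ g k z h = trans (Δ-apply g (Δ k z) h) (cong₂ _-_ (Δ-apply k z (h ⊟ g)) (Δ-apply k z h))

  Δ-⊞ : ∀ {r} (g k : H p r) z h → Δ (g ⊞ k) z h ≡ Δ g z h + Δ k z h + Δ g (Δ k z) h
  Δ-⊞ g k z h = begin
    Δ (g ⊞ k) z h
      ≡⟨ Δ-apply (g ⊞ k) z h ⟩
    z (h ⊟ (g ⊞ k)) - z h
      ≡⟨ cong (λ w → z w - z h) (⊟-⊞ h g k) ⟩
    z ((h ⊟ g) ⊟ k) - z h
      ≡⟨ solve 4 (λ a b c d → a :- d := (b :- d) :+ (c :- d) :+ ((a :- b) :- (c :- d))) refl (z ((h ⊟ g) ⊟ k)) (z (h ⊟ g)) (z (h ⊟ k)) (z h) ⟩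
    (z (h ⊟ g) - z h) + (z (h ⊟ k) - z h) + ((z ((h ⊟ g) ⊟ k) - z (h ⊟ g)) - (z (h ⊟ k) - z h))
      ≡⟨ cong₂ _+_ (cong₂ _+_ (Δ-apply g z h) (Δ-apply k z h)) (Δ-Δ g k z h) ⟨
    Δ g z h + Δ k z h + Δ g (Δ k z) h
      ∎
    where open ≡-Reasoning

  Δ-Δ-comm : ∀ {r} (g k : H p r) z h → Δ g (Δ k z) h ≡ Δ k (Δ g z) h
  Δ-Δ-comm g k z h = begin
    Δ g (Δ k z) h
      ≡⟨ Δ-Δ g k z h ⟩
    (z ((h ⊟ g) ⊟ k) - z (h ⊟ g)) - (z (h ⊟ k) - z h)
      ≡⟨ cong (λ w → (z w - z (h ⊟ g)) - (z (h ⊟ k) - z h)) (⊟-⊟-comm h g k) ⟩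
    (z ((h ⊟ k) ⊟ g) - z (h ⊟ g)) - (z (h ⊟ k) - z h)
      ≡⟨ solve 4 (λ a b c d → (a :- b) :- (c :- d) := (a :- c) :- (b :- d)) refl (z ((h ⊟ k) ⊟ g)) (z (h ⊟ g)) (z (h ⊟ k)) (z h) ⟩
    (z ((h ⊟ k) ⊟ g) - z (h ⊟ k)) - (z (h ⊟ g) - z h)
      ≡⟨ Δ-Δ k g z h ⟨
    Δ k (Δ g z) h
      ∎
    where open ≡-Reasoning

  Δ-∈I^ : ∀ {r} (g : H p r) {k y} → y ∈I^ k → Δ g y ∈I^ suc k
  Δ-∈I^ {r} g y∈I^k = pow-gen [ g ]-1 _ ([]-1∈I r g) y∈I^k

  ∈I^-suc⇒∈I^ : ∀ {r k} {x : Ω p r} → x ∈I^ suc k → x ∈I^ k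
  ∈I^-suc⇒∈I^ {k = zero}  _                   = pow-zero _
  ∈I^-suc⇒∈I^ {k = suc k} (pow-gen x y x∈I d) = pow-gen x y x∈I (∈I^-suc⇒∈I^ d)
  ∈I^-suc⇒∈I^ {k = suc k} pow-0               = pow-0
  ∈I^-suc⇒∈I^ {k = suc k} (pow-add d e)       = pow-add (∈I^-suc⇒∈I^ d) (∈I^-suc⇒∈I^ e)
  ∈I^-suc⇒∈I^ {k = suc k} (pow-scal c d)      = pow-scal c (∈I^-suc⇒∈I^ d)

  ∈I^-≤ : ∀ {r j k} {x : Ω p r} → j ≤ k → x ∈I^ k → x ∈I^ j
  ∈I^-≤ {k = zero}  z≤n d = d
  ∈I^-≤ {k = suc k} j≤k d with ℕₚ.m≤n⇒m<n∨m≡n j≤k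
  ... | inj₂ refl      = d
  ... | inj₁ (s≤s j≤k′) = ∈I^-≤ j≤k′ (∈I^-suc⇒∈I^ d)

  Δs : ∀ {r} → List (H p r) → Ω p r → Ω p r
  Δs []       y = y
  Δs (h ∷ hs) y = Δs hs (Δ h y)

  Δs-∈I^ : ∀ {r} (hs : List (H p r)) {k y} → y ∈I^ k → Δs hs y ∈I^ (List.length hs ℕ.+ k)
  Δs-∈I^ []       d = d
  Δs-∈I^ (h ∷ hs) {k} {y} d = subst (Δs hs (Δ h y) ∈I^_) (ℕₚ.+-suc (List.length hs) k) (Δs-∈I^ hs (Δ-∈I^ h d))

  Δs-cong : ∀ {r} (hs : List (H p r)) {x y} → x ≗ y → Δs hs x ≗ Δs hs y
  Δs-cong []       eq = eq
  Δs-cong (h ∷ hs) eq = Δs-cong hs (Δ-cong h eq)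

  Δs-⊕ : ∀ {r} (hs : List (H p r)) x y → Δs hs (x ⊕ y) ≗ Δs hs x ⊕ Δs hs y
  Δs-⊕ []       x y h = refl
  Δs-⊕ (g ∷ hs) x y h = trans (Δs-cong hs (Δ-⊕ g x y) h) (Δs-⊕ hs (Δ g x) (Δ g y) h)

  Δs-· : ∀ {r} (hs : List (H p r)) c x → Δs hs (c · x) ≗ c · Δs hs x
  Δs-· []       c x h = refl
  Δs-· (g ∷ hs) c x h = trans (Δs-cong hs (Δ-· g c x) h) (Δs-· hs c (Δ g x) h)

  Δs-0 : ∀ {r} (hs : List (H p r)) → Δs hs 0ᴼ ≗ 0ᴼ
  Δs-0 []       h = refl
  Δs-0 (g ∷ hs) h = trans (Δs-cong hs (Δ-0 g) h) (Δs-0 hs h)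

  Δs-++ : ∀ {r} (xs ys : List (H p r)) y → Δs (xs ++ ys) y ≡ Δs ys (Δs xs y)
  Δs-++ []       ys y = refl
  Δs-++ (x ∷ xs) ys y = Δs-++ xs ys (Δ x y)

  -- Binomial coefficients

  vandermonde : ∀ x y m → residue ((x ℕ.+ y) C m) ≡ ∑< (suc m) (λ j → residue (y C j) * residue (x C (m ℕ.∸ j)))
  vandermonde x zero m = begin
    residue ((x ℕ.+ 0) C m)                 ≡⟨ cong (λ n → residue (n C m)) (ℕₚ.+-identityʳ x) ⟩
    residue (x C m)                         ≡⟨ *-identityˡ _ ⟨
    1# * residue (x C m)                    ≡⟨ +-identityʳ _ ⟨
    1# * residue (x C m) + 0#               ≡⟨ cong (1# * residue (x C m) +_) (∑<-zero m (λ j _ → zeroˡ _)) ⟨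
    ∑< (suc m) (λ j → residue (0 C j) * residue (x C (m ℕ.∸ j))) ∎
    where open ≡-Reasoning
  vandermonde x (suc y) zero = sym (trans (+-identityʳ _) (*-identityˡ 1#))
  vandermonde x (suc y) (suc m) = begin
    residue ((x ℕ.+ suc y) C suc m)
      ≡⟨ cong (λ n → residue (n C suc m)) (ℕₚ.+-suc x y) ⟩
    residue (suc (x ℕ.+ y) C suc m)
      ≡⟨ cong residue (nCk+nC[k+1]≡[n+1]C[k+1] (x ℕ.+ y) m) ⟨
    residue ((x ℕ.+ y) C m ℕ.+ (x ℕ.+ y) C suc m)
      ≡⟨ residue-+ _ _ ⟩
    residue ((x ℕ.+ y) C m) + residue ((x ℕ.+ y) C suc m)
      ≡⟨ cong₂ _+_ (vandermonde x y m) (vandermonde x y (suc m)) ⟩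
    ∑< (suc m) (λ j → c y j * c x (m ℕ.∸ j)) + (1# * c x (suc m) + ∑< (suc m) (λ j → c y (suc j) * c x (m ℕ.∸ j)))
      ≡⟨ solve 3 (λ a b d → a :+ (con (ℤ.+ 1) :* b :+ d) := con (ℤ.+ 1) :* b :+ (a :+ d)) refl
               (∑< (suc m) (λ j → c y j * c x (m ℕ.∸ j))) (c x (suc m)) (∑< (suc m) (λ j → c y (suc j) * c x (m ℕ.∸ j))) ⟩
    1# * c x (suc m) + (∑< (suc m) (λ j → c y j * c x (m ℕ.∸ j)) + ∑< (suc m) (λ j → c y (suc j) * c x (m ℕ.∸ j)))
      ≡⟨ cong (1# * c x (suc m) +_) (∑<-+ (suc m) (λ j → c y j * c x (m ℕ.∸ j)) (λ j → c y (suc j) * c x (m ℕ.∸ j))) ⟨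
    1# * c x (suc m) + ∑< (suc m) (λ j → c y j * c x (m ℕ.∸ j) + c y (suc j) * c x (m ℕ.∸ j))
      ≡⟨ cong (1# * c x (suc m) +_) (∑<-cong (suc m) (λ j _ → pascal j (c x (m ℕ.∸ j)))) ⟩
    1# * c x (suc m) + ∑< (suc m) (λ j → c (suc y) (suc j) * c x (m ℕ.∸ j))
      ∎
    where
    open ≡-Reasoning
    c : ℕ → ℕ → F
    c n k = residue (n C k)
    pascal : ∀ j w → c y j * w + c y (suc j) * w ≡ c (suc y) (suc j) * w
    pascal j w = trans (sym (*-distribʳ-+ w (c y j) (c y (suc j))))
                       (cong (_* w) (trans (sym (residue-+ (y C j) (y C suc j))) (cong residue (nCk+nC[k+1]≡[n+1]C[k+1] y j))))

  binomial-theorem : ∀ t k → (t + 1#) ^ k ≡ t ^ k + ∑< k (λ j → residue (k C j) * t ^ j)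
  binomial-theorem t zero    = sym (+-identityʳ 1#)
  binomial-theorem t (suc k) = begin
    (t + 1#) * (t + 1#) ^ k       ≡⟨ cong ((t + 1#) *_) (binomial-theorem t k) ⟩
    (t + 1#) * (t ^ k + S)        ≡⟨ solve 3 (λ t a s → (t :+ con (ℤ.+ 1)) :* (a :+ s) := t :* a :+ (t :* s :+ (s :+ a))) refl t (t ^ k) S ⟩
    t * t ^ k + (t * S + (S + t ^ k))
      ≡⟨ cong (λ z → t * t ^ k + z) (trans (cong₂ _+_ tS (S+t^k k)) (solve 3 (λ a o b → a :+ (o :+ b) := o :+ (a :+ b)) refl A 1# B)) ⟩
    t * t ^ k + (1# + (A + B))
      ≡⟨ cong (λ z → t * t ^ k + (1# + z)) (trans (sym (∑<-+ k _ _)) (∑<-cong k (λ j _ → pascal j))) ⟩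
    t * t ^ k + (1# + ∑< k (λ j → residue (suc k C suc j) * t ^ suc j))
      ≡⟨ cong (λ z → t * t ^ k + (z + ∑< k (λ j → residue (suc k C suc j) * t ^ suc j))) (*-identityˡ 1#) ⟨
    t * t ^ k + ∑< (suc k) (λ j → residue (suc k C j) * t ^ j)
      ∎
    where
    open ≡-Reasoning
    S = ∑< k (λ j → residue (k C j) * t ^ j)
    A = ∑< k (λ j → residue (k C j) * t ^ suc j)
    B = ∑< k (λ j → residue (k C suc j) * t ^ suc j)
    tS : t * S ≡ A
    tS = trans (sym (∑<-*ˡ k t _)) (∑<-cong k (λ j _ → solve 3 (λ t a b → t :* (a :* b) := a :* (t :* b)) refl t (residue (k C j)) (t ^ j)))
    pascal : ∀ j → residue (k C j) * t ^ suc j + residue (k C suc j) * t ^ suc j ≡ residue (suc k C suc j) * t ^ suc j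
    pascal j = trans (sym (*-distribʳ-+ (t ^ suc j) (residue (k C j)) _))
                     (cong (_* t ^ suc j) (trans (sym (residue-+ (k C j) _)) (cong residue (nCk+nC[k+1]≡[n+1]C[k+1] k j))))
    S+t^k : ∀ n → ∑< n (λ j → residue (n C j) * t ^ j) + t ^ n ≡ 1# + ∑< n (λ j → residue (n C suc j) * t ^ suc j)
    S+t^k zero    = trans (+-identityˡ 1#) (sym (+-identityʳ 1#))
    S+t^k (suc n) = begin
      (1# * 1# + ∑< n (λ j → residue (suc n C suc j) * t ^ suc j)) + t ^ suc n
        ≡⟨ cong₂ _+_ (cong (_+ ∑< n (λ j → residue (suc n C suc j) * t ^ suc j)) (*-identityˡ 1#)) (trans (sym (*-identityˡ (t ^ suc n))) (cong (λ m → residue m * t ^ suc n) (sym (nCn≡1 (suc n))))) ⟩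
      (1# + ∑< n (λ j → residue (suc n C suc j) * t ^ suc j)) + residue (suc n C suc n) * t ^ suc n
        ≡⟨ +-assoc 1# _ _ ⟩
      1# + (∑< n (λ j → residue (suc n C suc j) * t ^ suc j) + residue (suc n C suc n) * t ^ suc n)
        ≡⟨ cong (1# +_) (∑<-last n (λ j → residue (suc n C suc j) * t ^ suc j)) ⟨
      1# + ∑< (suc n) (λ j → residue (suc n C suc j) * t ^ suc j)
        ∎

  binom : F → ℕ → F
  binom = binomF p

  binom-1 : ∀ a → binom a 1 ≡ a
  binom-1 a = trans (cong residue (nC1≡n (toℕ a))) (residue-toℕ a)

  binomial-difference : ∀ w t k → w * (t + 1#) ^ k - w * t ^ k ≡ ∑< k (λ j → residue (k C j) * (w * t ^ j))
  binomial-difference w t k = begin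
    w * (t + 1#) ^ k - w * t ^ k
      ≡⟨ cong (λ z → w * z - w * t ^ k) (binomial-theorem t k) ⟩
    w * (t ^ k + ∑< k (λ j → residue (k C j) * t ^ j)) - w * t ^ k
      ≡⟨ solve 3 (λ w a b → w :* (a :+ b) :- w :* a := w :* b) refl w (t ^ k) (∑< k (λ j → residue (k C j) * t ^ j)) ⟩
    w * ∑< k (λ j → residue (k C j) * t ^ j)
      ≡⟨ trans (sym (∑<-*ˡ k w _)) (∑<-cong k (λ j _ → solve 3 (λ w a b → w :* (a :* b) := a :* (w :* b)) refl w (residue (k C j)) (t ^ j))) ⟩
    ∑< k (λ j → residue (k C j) * (w * t ^ j))
      ∎
    where open ≡-Reasoning

  Weights : Set
  Weights = List (F × F)

  moment : Weights → ℕ → F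
  moment A k = ∑ A (λ wt → proj₁ wt * proj₂ wt ^ k)

  scale : F → Weights → Weights
  scale c = map (λ wt → c * proj₁ wt , proj₂ wt)

  shift : Weights → Weights
  shift = map (λ wt → proj₁ wt , proj₂ wt + 1#)

  moment-scale : ∀ c A k → moment (scale c A) k ≡ c * moment A k
  moment-scale c A k = trans (∑-map A _ _) (trans (∑-cong A (λ wt → *-assoc c (proj₁ wt) _)) (∑-*ˡ A c _))

  moment-difference : ∀ A k → moment (shift A ++ scale (- 1#) A) k ≡ ∑< k (λ j → residue (k C j) * moment A j)
  moment-difference A k = begin
    moment (shift A ++ scale (- 1#) A) k
      ≡⟨ trans (∑-++ (shift A) (scale (- 1#) A) _) (cong₂ _+_ (∑-map A _ _) (moment-scale (- 1#) A k)) ⟩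
    S⁺ + - 1# * moment A k
      ≡⟨ cong (S⁺ +_) (trans (sym (-‿distribˡ-* 1# _)) (trans (cong -_ (*-identityˡ _)) (sym (∑-neg A _)))) ⟩
    S⁺ + ∑ A (λ wt → - (proj₁ wt * proj₂ wt ^ k))
      ≡⟨ trans (sym (∑-+ A _ _)) (∑-cong A (λ wt → binomial-difference (proj₁ wt) (proj₂ wt) k)) ⟩
    ∑ A (λ wt → ∑< k (λ j → residue (k C j) * (proj₁ wt * proj₂ wt ^ j)))
      ≡⟨ trans (∑-∑<-comm A k _) (∑<-cong k (λ j _ → ∑-*ˡ A (residue (k C j)) _)) ⟩
    ∑< k (λ j → residue (k C j) * moment A j)
      ∎
    where
    open ≡-Reasoning
    S⁺ = ∑ A (λ wt → proj₁ wt * (proj₂ wt + 1#) ^ k)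

  0ᴼ-∈I^ : ∀ {r k} → 0ᴼ {r} ∈I^ k
  0ᴼ-∈I^ {k = zero}  = pow-zero _
  0ᴼ-∈I^ {k = suc k} = pow-0

  ⊕-∈I^ : ∀ {r k} {x y : Ω p r} → x ∈I^ k → y ∈I^ k → x ⊕ y ∈I^ k
  ⊕-∈I^ {k = zero}  _ _ = pow-zero _
  ⊕-∈I^ {k = suc k} d e = pow-add d e

  ·-∈I^ : ∀ {r k} c {x : Ω p r} → x ∈I^ k → c · x ∈I^ k
  ·-∈I^ {k = zero}  c _ = pow-zero _
  ·-∈I^ {k = suc k} c d = pow-scal c d

  ∑ᴼ : ∀ {A : Set} {r} → List A → (A → Ω p r) → Ω p r
  ∑ᴼ []       f = 0ᴼ
  ∑ᴼ (a ∷ xs) f = f a ⊕ ∑ᴼ xs f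

  ∑ᴼ-apply : ∀ {A : Set} {r} (xs : List A) (f : A → Ω p r) h → ∑ᴼ xs f h ≡ ∑ xs (λ a → f a h)
  ∑ᴼ-apply []       f h = refl
  ∑ᴼ-apply (a ∷ xs) f h = cong (f a h +_) (∑ᴼ-apply xs f h)

  ∑ᴼ-∈I^ : ∀ {A : Set} {r k} (xs : List A) (f : A → Ω p r) → (∀ a → f a ∈I^ k) → ∑ᴼ xs f ∈I^ k
  ∑ᴼ-∈I^ []       f d = 0ᴼ-∈I^
  ∑ᴼ-∈I^ (a ∷ xs) f d = ⊕-∈I^ (d a) (∑ᴼ-∈I^ xs f d)

  Δs-∑ᴼ : ∀ {A : Set} {r} (hs : List (H p r)) (xs : List A) (f : A → Ω p r) → Δs hs (∑ᴼ xs f) ≗ ∑ᴼ xs (λ a → Δs hs (f a))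
  Δs-∑ᴼ hs []       f h = Δs-0 hs h
  Δs-∑ᴼ hs (a ∷ xs) f h = trans (Δs-⊕ hs (f a) (∑ᴼ xs f) h) (cong (Δs hs (f a) h +_) (Δs-∑ᴼ hs xs f h))

  Δs-⋆ : ∀ {r} (hs : List (H p r)) a y → InI p r a → Δs hs (a ⋆ y) ≗ ∑ᴼ (allH p r) (λ g → a g · Δs (g ∷ hs) y)
  Δs-⋆ {r} hs a y a∈I h = begin
    Δs hs (a ⋆ y) h                                    ≡⟨ Δs-cong hs (λ k → trans (⋆-∑Δ a y k a∈I) (sym (∑ᴼ-apply (allH p r) (λ g → a g · Δ g y) k))) h ⟩
    Δs hs (∑ᴼ (allH p r) (λ g → a g · Δ g y)) h        ≡⟨ Δs-∑ᴼ hs (allH p r) (λ g → a g · Δ g y) h ⟩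
    ∑ᴼ (allH p r) (λ g → Δs hs (a g · Δ g y)) h        ≡⟨ ∑ᴼ-apply (allH p r) _ h ⟩
    ∑H r (λ g → Δs hs (a g · Δ g y) h)                 ≡⟨ ∑-cong (allH p r) (λ g → Δs-· hs (a g) (Δ g y) h) ⟩
    ∑H r (λ g → (a g · Δs (g ∷ hs) y) h)               ≡⟨ ∑ᴼ-apply (allH p r) _ h ⟨
    ∑ᴼ (allH p r) (λ g → a g · Δs (g ∷ hs) y) h        ∎
    where open ≡-Reasoning

  centred : ∀ {r} → Ω p r → Ω p r
  centred y h = y h - aug p _ y * [ 0ᴴ ] h

  centred-∈I : ∀ {r} (y : Ω p r) → InI p r (centred y)
  centred-∈I {r} y = begin
    ∑H r (λ h → y h - ε * [ 0ᴴ ] h)          ≡⟨ ∑-+ (allH p r) y _ ⟩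
    ε + ∑H r (λ h → - (ε * [ 0ᴴ ] h))        ≡⟨ cong (ε +_) (trans (∑-neg (allH p r) _) (cong -_ (trans (∑-*ˡ (allH p r) ε [ 0ᴴ ]) (trans (cong (ε *_) (aug-[] r 0ᴴ)) (*-identityʳ ε))))) ⟩
    ε - ε                                    ≡⟨ -‿inverseʳ ε ⟩
    0#                                       ∎
    where
    open ≡-Reasoning
    ε = aug p r y

  augmentation-split : ∀ {r} (y : Ω p r) → y ≗ aug p r y · [ 0ᴴ ] ⊕ centred y ⋆ [ 0ᴴ ]
  augmentation-split y h = trans
    (solve 3 (λ a b c → a := b :* c :+ (a :- b :* c)) refl (y h) (aug p _ y) ([ 0ᴴ ] h))
    (cong (aug p _ y * [ 0ᴴ ] h +_) (sym (⋆-[0] (centred y) h)))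

  Multiadditive : ∀ {r} → (List (H p r) → F) → Set
  Multiadditive {r} Φ = ∀ (xs ys : List (H p r)) g k → Φ (xs ++ (g ⊞ k) ∷ ys) ≡ Φ (xs ++ g ∷ ys) + Φ (xs ++ k ∷ ys)

  Symmetric : ∀ {r} → (List (H p r) → F) → Set
  Symmetric {r} Φ = ∀ (xs : List (H p r)) a b ys → Φ (xs ++ a ∷ b ∷ ys) ≡ Φ (xs ++ b ∷ a ∷ ys)

  module _ {r : ℕ} (n : ℕ) (Φ : List (H p r) → F) where

    MultiadditiveAt : Set
    MultiadditiveAt = ∀ xs ys g k → List.length xs ℕ.+ suc (List.length ys) ≡ n →
                      Φ (xs ++ (g ⊞ k) ∷ ys) ≡ Φ (xs ++ g ∷ ys) + Φ (xs ++ k ∷ ys)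

    SymmetricAt : Set
    SymmetricAt = ∀ xs a b ys → List.length xs ℕ.+ suc (suc (List.length ys)) ≡ n →
                  Φ (xs ++ a ∷ b ∷ ys) ≡ Φ (xs ++ b ∷ a ∷ ys)

    extendByZero : List (H p r) → F
    extendByZero hs = select (List.length hs ℕ.≟ n) (Φ hs)

    extendByZero-≡ : ∀ hs → List.length hs ≡ n → extendByZero hs ≡ Φ hs
    extendByZero-≡ hs = select-yes (List.length hs ℕ.≟ n)

    extendByZero-multiadditive : MultiadditiveAt → Multiadditive extendByZero
    extendByZero-multiadditive add xs ys g k with List.length xs ℕ.+ suc (List.length ys) ℕ.≟ n
    ... | yes eq = trans (extendByZero-≡ _ (len eq))
                         (trans (add xs ys g k eq) (sym (cong₂ _+_ (extendByZero-≡ _ (len eq)) (extendByZero-≡ _ (len eq)))))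
      where
      len : ∀ {a} → List.length xs ℕ.+ suc (List.length ys) ≡ n → List.length (xs ++ a ∷ ys) ≡ n
      len = trans (Listₚ.length-++ xs)
    ... | no neq = trans (off _) (sym (trans (cong₂ _+_ (off _) (off _)) (+-identityʳ 0#)))
      where
      off : ∀ a → extendByZero (xs ++ a ∷ ys) ≡ 0#
      off a = select-no (List.length (xs ++ a ∷ ys) ℕ.≟ n) (λ eq → neq (trans (sym (Listₚ.length-++ xs)) eq))

    extendByZero-symmetric : SymmetricAt → Symmetric extendByZero
    extendByZero-symmetric sym′ xs a b ys with List.length xs ℕ.+ suc (suc (List.length ys)) ℕ.≟ n
    ... | yes eq = trans (extendByZero-≡ _ (trans (Listₚ.length-++ xs) eq))
                         (trans (sym′ xs a b ys eq) (sym (extendByZero-≡ _ (trans (Listₚ.length-++ xs) eq))))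
    ... | no neq = trans (off a b) (sym (off b a))
      where
      off : ∀ a b → extendByZero (xs ++ a ∷ b ∷ ys) ≡ 0#
      off a b = select-no (List.length (xs ++ a ∷ b ∷ ys) ℕ.≟ n) (λ eq → neq (trans (sym (Listₚ.length-++ xs)) eq))

  module DualGradedProperties {r n} (ψ : DualGraded p r n) where

    Δs-∈I^ⁿ : ∀ (hs : List (H p r)) {k y} → y ∈I^ k → List.length hs ℕ.+ k ≡ n → Δs hs y ∈I^ n
    Δs-∈I^ⁿ hs {y = y} d eq = subst (Δs hs y ∈I^_) eq (Δs-∈I^ hs d)

    φ-0 : φ ψ 0ᴼ ≡ 0#
    φ-0 = trans (resp ψ 0ᴼ-∈I^ (λ h → sym (zeroˡ 0#))) (trans (homog ψ 0# 0ᴼ-∈I^) (zeroˡ _))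

    φ-∑ᴼ : ∀ {A : Set} (xs : List A) (f : A → Ω p r) → (∀ a → f a ∈I^ n) → φ ψ (∑ᴼ xs f) ≡ ∑ xs (λ a → φ ψ (f a))
    φ-∑ᴼ []       f d = φ-0
    φ-∑ᴼ (a ∷ xs) f d = trans (additive ψ (d a) (∑ᴼ-∈I^ xs f d)) (cong (φ ψ (f a) +_) (φ-∑ᴼ xs f d))

    module _ (hs : List (H p r)) {k} (|hs|+k≡n : List.length hs ℕ.+ k ≡ n) where

      φ-Δs-0 : φ ψ (Δs hs 0ᴼ) ≡ 0#
      φ-Δs-0 = trans (resp ψ (Δs-∈I^ⁿ hs (0ᴼ-∈I^ {k = k}) |hs|+k≡n) (Δs-0 hs)) φ-0

      φ-Δs-⊕ : ∀ {x y} → x ∈I^ k → y ∈I^ k → φ ψ (Δs hs (x ⊕ y)) ≡ φ ψ (Δs hs x) + φ ψ (Δs hs y)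
      φ-Δs-⊕ {x} {y} d e = trans (resp ψ (Δs-∈I^ⁿ hs (⊕-∈I^ d e) |hs|+k≡n) (Δs-⊕ hs x y))
                                 (additive ψ (Δs-∈I^ⁿ hs d |hs|+k≡n) (Δs-∈I^ⁿ hs e |hs|+k≡n))

      φ-Δs-· : ∀ c {x} → x ∈I^ k → φ ψ (Δs hs (c · x)) ≡ c * φ ψ (Δs hs x)
      φ-Δs-· c {x} d = trans (resp ψ (Δs-∈I^ⁿ hs (·-∈I^ c d) |hs|+k≡n) (Δs-· hs c x)) (homog ψ c (Δs-∈I^ⁿ hs d |hs|+k≡n))

    φ-Δs-⋆ : ∀ (hs : List (H p r)) {k a y} → InI p r a → y ∈I^ k → List.length hs ℕ.+ suc k ≡ n →
             φ ψ (Δs hs (a ⋆ y)) ≡ ∑H r (λ g → a g * φ ψ (Δs (g ∷ hs) y))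
    φ-Δs-⋆ hs {k} {a} {y} a∈I d eq = begin
      φ ψ (Δs hs (a ⋆ y))                                ≡⟨ resp ψ (Δs-∈I^ⁿ hs (pow-gen a y a∈I d) eq) (Δs-⋆ hs a y a∈I) ⟩
      φ ψ (∑ᴼ (allH p r) (λ g → a g · Δs (g ∷ hs) y))    ≡⟨ φ-∑ᴼ (allH p r) _ (λ g → ·-∈I^ (a g) (Δs-∈I^ⁿ (g ∷ hs) d eq′)) ⟩
      ∑H r (λ g → φ ψ (a g · Δs (g ∷ hs) y))             ≡⟨ ∑-cong (allH p r) (λ g → homog ψ (a g) (Δs-∈I^ⁿ (g ∷ hs) d eq′)) ⟩
      ∑H r (λ g → a g * φ ψ (Δs (g ∷ hs) y))             ∎
      where
      open ≡-Reasoning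
      eq′ : suc (List.length hs) ℕ.+ k ≡ n
      eq′ = trans (sym (ℕₚ.+-suc (List.length hs) k)) eq

    φ-Δs-aug : ∀ (hs : List (H p r)) y → List.length hs ≡ n → φ ψ (Δs hs y) ≡ aug p r y * φ ψ (Δs hs [ 0ᴴ ])
    φ-Δs-aug hs y |hs|≡n = begin
      φ ψ (Δs hs y)
        ≡⟨ resp ψ (Δs-∈I^ⁿ hs (pow-zero y) eq) (Δs-cong hs (augmentation-split y)) ⟩
      φ ψ (Δs hs (ε · [ 0ᴴ ] ⊕ centred y ⋆ [ 0ᴴ ]))
        ≡⟨ φ-Δs-⊕ hs eq (pow-zero _) (pow-zero _) ⟩
      φ ψ (Δs hs (ε · [ 0ᴴ ])) + φ ψ (Δs hs (centred y ⋆ [ 0ᴴ ]))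
        ≡⟨ cong₂ _+_ (φ-Δs-· hs eq ε (pow-zero _)) (vanish ψ centred-term∈Iⁿ⁺¹) ⟩
      ε * φ ψ (Δs hs [ 0ᴴ ]) + 0#
        ≡⟨ +-identityʳ _ ⟩
      ε * φ ψ (Δs hs [ 0ᴴ ])
        ∎
      where
      open ≡-Reasoning
      ε = aug p r y
      eq : List.length hs ℕ.+ 0 ≡ n
      eq = trans (ℕₚ.+-identityʳ _) |hs|≡n
      centred-term∈Iⁿ⁺¹ : Δs hs (centred y ⋆ [ 0ᴴ ]) ∈I^ suc n
      centred-term∈Iⁿ⁺¹ = subst (Δs hs (centred y ⋆ [ 0ᴴ ]) ∈I^_) (trans (ℕₚ.+-comm (List.length hs) 1) (cong suc |hs|≡n))
                                (Δs-∈I^ hs (pow-gen (centred y) [ 0ᴴ ] (centred-∈I y) (pow-zero _)))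

    monomial : List (H p r) → F
    monomial hs = φ ψ (Δs hs [ 0ᴴ ])

    -- By `Δ-⊞`; the cross term Δ g (Δ k z) lies in Iⁿ⁺¹.
    monomial-multiadditive : MultiadditiveAt n monomial
    monomial-multiadditive xs ys g k eq = begin
      φ ψ (Δs (xs ++ (g ⊞ k) ∷ ys) [ 0ᴴ ])
        ≡⟨ cong (φ ψ) (Δs-++ xs ((g ⊞ k) ∷ ys) [ 0ᴴ ]) ⟩
      φ ψ (Δs ys (Δ (g ⊞ k) z))
        ≡⟨ resp ψ (Δs-∈I^ⁿ ys (Δ-∈I^ (g ⊞ k) z∈I) eq′) (Δs-cong ys (Δ-⊞ g k z)) ⟩
      φ ψ (Δs ys (Δ g z ⊕ Δ k z ⊕ Δ g (Δ k z)))
        ≡⟨ φ-Δs-⊕ ys eq′ (⊕-∈I^ (Δ-∈I^ g z∈I) (Δ-∈I^ k z∈I)) (∈I^-suc⇒∈I^ (Δ-∈I^ g (Δ-∈I^ k z∈I))) ⟩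
      φ ψ (Δs ys (Δ g z ⊕ Δ k z)) + φ ψ (Δs ys (Δ g (Δ k z)))
        ≡⟨ cong₂ _+_ (φ-Δs-⊕ ys eq′ (Δ-∈I^ g z∈I) (Δ-∈I^ k z∈I)) (vanish ψ (subst (Δs ys (Δ g (Δ k z)) ∈I^_) eq″ (Δs-∈I^ ys (Δ-∈I^ g (Δ-∈I^ k z∈I))))) ⟩
      φ ψ (Δs ys (Δ g z)) + φ ψ (Δs ys (Δ k z)) + 0#
        ≡⟨ +-identityʳ _ ⟩
      φ ψ (Δs ys (Δ g z)) + φ ψ (Δs ys (Δ k z))
        ≡⟨ cong₂ _+_ (cong (φ ψ) (Δs-++ xs (g ∷ ys) [ 0ᴴ ])) (cong (φ ψ) (Δs-++ xs (k ∷ ys) [ 0ᴴ ])) ⟨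
      monomial (xs ++ g ∷ ys) + monomial (xs ++ k ∷ ys)
        ∎
      where
      open ≡-Reasoning
      z = Δs xs [ 0ᴴ ]
      z∈I : z ∈I^ (List.length xs ℕ.+ 0)
      z∈I = Δs-∈I^ xs (pow-zero [ 0ᴴ ])
      eq′ : List.length ys ℕ.+ suc (List.length xs ℕ.+ 0) ≡ n
      eq′ = trans (cong (λ i → List.length ys ℕ.+ suc i) (ℕₚ.+-identityʳ (List.length xs)))
                  (trans (ℕₚ.+-suc (List.length ys) (List.length xs))
                  (trans (cong suc (ℕₚ.+-comm (List.length ys) (List.length xs)))
                  (trans (sym (ℕₚ.+-suc (List.length xs) (List.length ys))) eq)))
      eq″ : List.length ys ℕ.+ suc (suc (List.length xs ℕ.+ 0)) ≡ suc n
      eq″ = trans (ℕₚ.+-suc (List.length ys) _) (cong suc eq′)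

    monomial-symmetric : SymmetricAt n monomial
    monomial-symmetric xs a b ys eq = begin
      φ ψ (Δs (xs ++ a ∷ b ∷ ys) [ 0ᴴ ])   ≡⟨ cong (φ ψ) (Δs-++ xs (a ∷ b ∷ ys) [ 0ᴴ ]) ⟩
      φ ψ (Δs ys (Δ b (Δ a z)))            ≡⟨ resp ψ (Δs-∈I^ⁿ ys (Δ-∈I^ b (Δ-∈I^ a z∈I)) eq′) (Δs-cong ys (Δ-Δ-comm b a z)) ⟩
      φ ψ (Δs ys (Δ a (Δ b z)))            ≡⟨ cong (φ ψ) (Δs-++ xs (b ∷ a ∷ ys) [ 0ᴴ ]) ⟨
      φ ψ (Δs (xs ++ b ∷ a ∷ ys) [ 0ᴴ ])   ∎
      where
      open ≡-Reasoning
      z = Δs xs [ 0ᴴ ]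
      z∈I : z ∈I^ (List.length xs ℕ.+ 0)
      z∈I = Δs-∈I^ xs (pow-zero [ 0ᴴ ])
      eq′ : List.length ys ℕ.+ suc (suc (List.length xs ℕ.+ 0)) ≡ n
      eq′ = trans (cong (λ i → List.length ys ℕ.+ suc (suc i)) (ℕₚ.+-identityʳ (List.length xs)))
                  (trans (ℕₚ.+-comm (List.length ys) _)
                  (trans (cong suc (sym (ℕₚ.+-suc (List.length xs) (List.length ys))))
                  (trans (sym (ℕₚ.+-suc (List.length xs) (suc (List.length ys)))) eq)))

  DualGraded-ext : ∀ {r n} (ψ₁ ψ₂ : DualGraded p r n) →
                   (∀ hs → List.length hs ≡ n → φ ψ₁ (Δs hs [ 0ᴴ ]) ≡ φ ψ₂ (Δs hs [ 0ᴴ ])) →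
                   ∀ {x} → x ∈I^ n → φ ψ₁ x ≡ φ ψ₂ x
  DualGraded-ext {r} {n} ψ₁ ψ₂ agree d = go d [] refl
    where
    module P₁ = DualGradedProperties ψ₁
    module P₂ = DualGradedProperties ψ₂
    go : ∀ {k y} → y ∈I^ k → ∀ hs → List.length hs ℕ.+ k ≡ n → φ ψ₁ (Δs hs y) ≡ φ ψ₂ (Δs hs y)
    go (pow-zero y) hs eq = trans (P₁.φ-Δs-aug hs y |hs|≡n)
      (trans (cong (aug p r y *_) (agree hs |hs|≡n)) (sym (P₂.φ-Δs-aug hs y |hs|≡n)))
      where
      |hs|≡n : List.length hs ≡ n
      |hs|≡n = trans (sym (ℕₚ.+-identityʳ _)) eq
    go {suc k} (pow-gen a y a∈I d) hs eq = trans (P₁.φ-Δs-⋆ hs a∈I d eq)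
      (trans (∑-cong (allH p r) (λ g → cong (a g *_) (go d (g ∷ hs) (trans (sym (ℕₚ.+-suc (List.length hs) k)) eq))))
             (sym (P₂.φ-Δs-⋆ hs a∈I d eq)))
    go pow-0 hs eq = trans (P₁.φ-Δs-0 hs eq) (sym (P₂.φ-Δs-0 hs eq))
    go (pow-add d e) hs eq = trans (P₁.φ-Δs-⊕ hs eq d e) (trans (cong₂ _+_ (go d hs eq) (go e hs eq)) (sym (P₂.φ-Δs-⊕ hs eq d e)))
    go (pow-scal c d) hs eq = trans (P₁.φ-Δs-· hs eq c d) (trans (cong (c *_) (go d hs eq)) (sym (P₂.φ-Δs-· hs eq c d)))

  prod : ∀ {r} → Hom p r → List (H p r) → F
  prod χ []       = 1#
  prod χ (h ∷ hs) = fun χ h * prod χ hs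

  prod-++ : ∀ {r} (χ : Hom p r) xs ys → prod χ (xs ++ ys) ≡ prod χ xs * prod χ ys
  prod-++ χ []       ys = sym (*-identityˡ _)
  prod-++ χ (x ∷ xs) ys = trans (cong (fun χ x *_) (prod-++ χ xs ys)) (sym (*-assoc (fun χ x) _ _))

  hom-0ᴴ : ∀ {r} (χ : Hom p r) → fun χ 0ᴴ ≡ 0#
  hom-0ᴴ χ = x+x≈x⇒x≈0 _ (trans (sym (hom χ 0ᴴ 0ᴴ)) (cong (fun χ) (⊞-identityʳ 0ᴴ)))

  p[_,_] : ∀ {r} → Hom p r → ℕ → Ω p r → F
  p[ χ , m ] x = ∑H _ (λ h → x h * binom (fun χ h) m)

  pχ≡p[] : ∀ {r} n (χ : Hom p r) x → pχ p r n χ x ≡ p[ χ , n ] x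
  pχ≡p[] {r} n χ x = ∑-cong (allH p r) (λ h → cong (x h *_) (first-entry (fun χ h)))
    where
    first-entry : ∀ a → binomMat p n a Fin.zero (Fin.fromℕ n) ≡ binom a n
    first-entry a with 0 ℕ.≤? toℕ (Fin.fromℕ n)
    ... | yes _  = cong (binom a) (Finₚ.toℕ-fromℕ n)
    ... | no 0≰n = ⊥-elim (0≰n z≤n)

  p[]-cong : ∀ {r} (χ : Hom p r) m {x y} → x ≗ y → p[ χ , m ] x ≡ p[ χ , m ] y
  p[]-cong {r} χ m eq = ∑-cong (allH p r) (λ h → cong (_* _) (eq h))

  p[]-⊕ : ∀ {r} (χ : Hom p r) m x y → p[ χ , m ] (x ⊕ y) ≡ p[ χ , m ] x + p[ χ , m ] y
  p[]-⊕ {r} χ m x y = trans (∑-cong (allH p r) (λ h → *-distribʳ-+ _ (x h) (y h))) (∑-+ (allH p r) _ _)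

  p[]-· : ∀ {r} (χ : Hom p r) m c x → p[ χ , m ] (c · x) ≡ c * p[ χ , m ] x
  p[]-· {r} χ m c x = trans (∑-cong (allH p r) (λ h → *-assoc c (x h) _)) (∑-*ˡ (allH p r) c _)

  p[]-0 : ∀ {r} (χ : Hom p r) m → p[ χ , m ] 0ᴼ ≡ 0#
  p[]-0 {r} χ m = ∑-zero (allH p r) (λ h → zeroˡ _)

  p[]-⋆ : ∀ {r} (χ : Hom p r) m (a y : Ω p r) → InI p r a → p[ χ , m ] (a ⋆ y) ≡ ∑H r (λ g → a g * p[ χ , m ] (Δ g y))
  p[]-⋆ {r} χ m a y a∈I = begin
    ∑H r (λ h → (a ⋆ y) h * B h)                    ≡⟨ ∑-cong (allH p r) (λ h → cong (_* B h) (⋆-∑Δ a y h a∈I)) ⟩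
    ∑H r (λ h → ∑H r (λ g → a g * Δ g y h) * B h)   ≡⟨ ∑-cong (allH p r) (λ h → sym (∑-*ʳ (allH p r) (B h) _)) ⟩
    ∑H r (λ h → ∑H r (λ g → a g * Δ g y h * B h))   ≡⟨ ∑-comm (allH p r) (allH p r) _ ⟩
    ∑H r (λ g → ∑H r (λ h → a g * Δ g y h * B h))   ≡⟨ ∑-cong (allH p r) (λ g → trans (∑-cong (allH p r) (λ h → *-assoc (a g) _ _)) (∑-*ˡ (allH p r) (a g) _)) ⟩
    ∑H r (λ g → a g * p[ χ , m ] (Δ g y))           ∎
    where
    open ≡-Reasoning
    B : H p r → F
    B h = binom (fun χ h) m

  p[]-[0] : ∀ {r} (χ : Hom p r) → p[ χ , 0 ] [ 0ᴴ ] ≡ 1#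
  p[]-[0] {r} χ = trans (∑-cong (allH p r) (λ h → *-identityʳ ([ 0ᴴ ] h))) (aug-[] r 0ᴴ)

  -- Symmetric multiadditive forms

  combination : ∀ {r} → List (F × Hom p r) → List (H p r) → F
  combination L hs = ∑ L (λ cχ → proj₁ cχ * prod (proj₂ cχ) hs)

  combination-multiadditive : ∀ {r} (L : List (F × Hom p r)) → Multiadditive (combination L)
  combination-multiadditive L xs ys g k = trans (∑-cong L term) (∑-+ L _ _)
    where
    term : ∀ cχ → proj₁ cχ * prod (proj₂ cχ) (xs ++ (g ⊞ k) ∷ ys) ≡
                  proj₁ cχ * prod (proj₂ cχ) (xs ++ g ∷ ys) + proj₁ cχ * prod (proj₂ cχ) (xs ++ k ∷ ys)
    term (c , χ) = begin
      c * prod χ (xs ++ (g ⊞ k) ∷ ys)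
        ≡⟨ cong (c *_) (prod-++ χ xs _) ⟩
      c * (prod χ xs * (fun χ (g ⊞ k) * prod χ ys))
        ≡⟨ cong (λ z → c * (prod χ xs * (z * prod χ ys))) (hom χ g k) ⟩
      c * (prod χ xs * ((fun χ g + fun χ k) * prod χ ys))
        ≡⟨ solve 5 (λ c a b d e → c :* (a :* ((b :+ d) :* e)) := c :* (a :* (b :* e)) :+ c :* (a :* (d :* e))) refl c (prod χ xs) (fun χ g) (fun χ k) (prod χ ys) ⟩
      c * (prod χ xs * (fun χ g * prod χ ys)) + c * (prod χ xs * (fun χ k * prod χ ys))
        ≡⟨ cong₂ _+_ (cong (c *_) (prod-++ χ xs _)) (cong (c *_) (prod-++ χ xs _)) ⟨
      c * prod χ (xs ++ g ∷ ys) + c * prod χ (xs ++ k ∷ ys)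
        ∎
      where open ≡-Reasoning

  additive⇒linear : (f : F → F) → (∀ a b → f (a + b) ≡ f a + f b) → ∀ a → f a ≡ a * f 1#
  additive⇒linear f additive a = trans (cong f (sym (residue-toℕ a))) (trans (on-residues (toℕ a)) (cong (_* f 1#) (residue-toℕ a)))
    where
    f0≡0 : f 0# ≡ 0#
    f0≡0 = x+x≈x⇒x≈0 _ (trans (sym (additive 0# 0#)) (cong f (+-identityʳ 0#)))
    on-residues : ∀ m → f (residue m) ≡ residue m * f 1#
    on-residues zero    = trans f0≡0 (sym (zeroˡ _))
    on-residues (suc m) = begin
      f (residue (suc m))          ≡⟨ cong f (residue-+ 1 m) ⟩
      f (1# + residue m)           ≡⟨ additive 1# (residue m) ⟩
      f 1# + f (residue m)         ≡⟨ cong (f 1# +_) (on-residues m) ⟩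
      f 1# + residue m * f 1#      ≡⟨ solve 2 (λ a b → a :+ b :* a := (con (ℤ.+ 1) :+ b) :* a) refl (f 1#) (residue m) ⟩
      (1# + residue m) * f 1#      ≡⟨ cong (_* f 1#) (residue-+ 1 m) ⟨
      residue (suc m) * f 1#       ∎
      where open ≡-Reasoning

  nothings : ∀ {A : Set} → List (Maybe A) → ℕ
  nothings []             = 0
  nothings (nothing ∷ gs) = suc (nothings gs)
  nothings (just _ ∷ gs)  = nothings gs

  length≡nothings+catMaybes : ∀ {A : Set} (gs : List (Maybe A)) → List.length gs ≡ nothings gs ℕ.+ List.length (catMaybes gs)
  length≡nothings+catMaybes []             = refl
  length≡nothings+catMaybes (nothing ∷ gs) = cong suc (length≡nothings+catMaybes gs)
  length≡nothings+catMaybes (just _ ∷ gs)  = trans (cong suc (length≡nothings+catMaybes gs)) (sym (ℕₚ.+-suc (nothings gs) _))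

  -- Splitting off the first coordinate: H p (suc r) is spanned by u₁ = (1, 0) and by 0 ∷ H p r.
  module FirstCoordinate {r : ℕ} where

    u₁ : H p (suc r)
    u₁ = 1# ∷ 0ᴴ

    ι₀ : H p r → H p (suc r)
    ι₀ h = 0# ∷ h

    generator : Maybe (H p r) → H p (suc r)
    generator nothing  = u₁
    generator (just h) = ι₀ h

    ι₀-⊞ : ∀ g k → ι₀ (g ⊞ k) ≡ ι₀ g ⊞ ι₀ k
    ι₀-⊞ g k = cong (_∷ g ⊞ k) (sym (+-identityʳ 0#))

    split : ∀ a h → _≡_ {A = H p (suc r)} (a ∷ h) ((a ∷ 0ᴴ) ⊞ ι₀ h)
    split a h = cong₂ _∷_ (sym (+-identityʳ a)) (sym (⊞-identityˡ h))

    module _ (Φ : List (H p (suc r)) → F) (additive : Multiadditive Φ) where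

      multiadditive-split : ∀ X Y a h → Φ (X ++ (a ∷ h) ∷ Y) ≡ a * Φ (X ++ u₁ ∷ Y) + Φ (X ++ ι₀ h ∷ Y)
      multiadditive-split X Y a h = begin
        Φ (X ++ (a ∷ h) ∷ Y)                          ≡⟨ cong (λ z → Φ (X ++ z ∷ Y)) (split a h) ⟩
        Φ (X ++ ((a ∷ 0ᴴ) ⊞ ι₀ h) ∷ Y)                ≡⟨ additive X Y (a ∷ 0ᴴ) (ι₀ h) ⟩
        Φ (X ++ (a ∷ 0ᴴ) ∷ Y) + Φ (X ++ ι₀ h ∷ Y)     ≡⟨ cong (_+ Φ (X ++ ι₀ h ∷ Y)) (additive⇒linear (λ b → Φ (X ++ (b ∷ 0ᴴ) ∷ Y)) first a) ⟩
        a * Φ (X ++ u₁ ∷ Y) + Φ (X ++ ι₀ h ∷ Y)       ∎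
        where
        open ≡-Reasoning
        first : ∀ b c → Φ (X ++ ((b + c) ∷ 0ᴴ) ∷ Y) ≡ Φ (X ++ (b ∷ 0ᴴ) ∷ Y) + Φ (X ++ (c ∷ 0ᴴ) ∷ Y)
        first b c = trans (cong (λ z → Φ (X ++ (b + c ∷ z) ∷ Y)) (sym (⊞-identityʳ 0ᴴ))) (additive X Y (b ∷ 0ᴴ) (c ∷ 0ᴴ))

    multiadditive-ext : ∀ n (Φ₁ Φ₂ : List (H p (suc r)) → F) → Multiadditive Φ₁ → Multiadditive Φ₂ →
                        (∀ gs → List.length gs ≡ n → Φ₁ (map generator gs) ≡ Φ₂ (map generator gs)) →
                        ∀ hs → List.length hs ≡ n → Φ₁ hs ≡ Φ₂ hs
    multiadditive-ext n Φ₁ Φ₂ add₁ add₂ agree hs |hs|≡n = go hs [] |hs|≡n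
      where
      snoc : ∀ gs m hs → map generator gs ++ generator m ∷ hs ≡ map generator (gs ++ m ∷ []) ++ hs
      snoc gs m hs = trans (sym (Listₚ.++-assoc (map generator gs) (generator m ∷ []) hs))
                           (cong (_++ hs) (sym (Listₚ.map-++ generator gs (m ∷ []))))
      go : ∀ hs gs → List.length gs ℕ.+ List.length hs ≡ n → Φ₁ (map generator gs ++ hs) ≡ Φ₂ (map generator gs ++ hs)
      go [] gs eq = trans (cong Φ₁ (Listₚ.++-identityʳ _))
                          (trans (agree gs (trans (sym (ℕₚ.+-identityʳ _)) eq)) (cong Φ₂ (sym (Listₚ.++-identityʳ _))))
      go ((a ∷ h) ∷ hs) gs eq = begin
        Φ₁ (X ++ (a ∷ h) ∷ hs)                        ≡⟨ multiadditive-split Φ₁ add₁ X hs a h ⟩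
        a * Φ₁ (X ++ u₁ ∷ hs) + Φ₁ (X ++ ι₀ h ∷ hs)   ≡⟨ cong₂ (λ z w → a * z + w) (next nothing) (next (just h)) ⟩
        a * Φ₂ (X ++ u₁ ∷ hs) + Φ₂ (X ++ ι₀ h ∷ hs)   ≡⟨ multiadditive-split Φ₂ add₂ X hs a h ⟨
        Φ₂ (X ++ (a ∷ h) ∷ hs)                        ∎
        where
        open ≡-Reasoning
        X = map generator gs
        next : ∀ m → Φ₁ (X ++ generator m ∷ hs) ≡ Φ₂ (X ++ generator m ∷ hs)
        next m = trans (cong Φ₁ (snoc gs m hs)) (trans (go hs (gs ++ m ∷ [])
          (trans (cong (ℕ._+ List.length hs) (Listₚ.length-++ gs)) (trans (ℕₚ.+-assoc (List.length gs) 1 _) eq)))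
          (cong Φ₂ (sym (snoc gs m hs))))

    module _ (Φ : List (H p (suc r)) → F) where

      sliced : ℕ → List (H p r) → F
      sliced s hs = Φ (List.replicate s u₁ ++ map ι₀ hs)

      private
        regroup : ∀ s xs z (ys : List (H p r)) →
                  List.replicate s u₁ ++ map ι₀ (xs ++ z ∷ ys) ≡ (List.replicate s u₁ ++ map ι₀ xs) ++ ι₀ z ∷ map ι₀ ys
        regroup s xs z ys = trans (cong (List.replicate s u₁ ++_) (Listₚ.map-++ ι₀ xs (z ∷ ys)))
                                  (sym (Listₚ.++-assoc (List.replicate s u₁) (map ι₀ xs) _))

      sliced-multiadditive : Multiadditive Φ → ∀ s → Multiadditive (sliced s)
      sliced-multiadditive additive s xs ys g k = begin
        sliced s (xs ++ (g ⊞ k) ∷ ys)                        ≡⟨ cong Φ (regroup s xs (g ⊞ k) ys) ⟩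
        Φ (A ++ ι₀ (g ⊞ k) ∷ map ι₀ ys)                      ≡⟨ cong (λ z → Φ (A ++ z ∷ map ι₀ ys)) (ι₀-⊞ g k) ⟩
        Φ (A ++ (ι₀ g ⊞ ι₀ k) ∷ map ι₀ ys)                   ≡⟨ additive A (map ι₀ ys) (ι₀ g) (ι₀ k) ⟩
        Φ (A ++ ι₀ g ∷ map ι₀ ys) + Φ (A ++ ι₀ k ∷ map ι₀ ys) ≡⟨ cong₂ _+_ (cong Φ (regroup s xs g ys)) (cong Φ (regroup s xs k ys)) ⟨
        sliced s (xs ++ g ∷ ys) + sliced s (xs ++ k ∷ ys)    ∎
        where
        open ≡-Reasoning
        A = List.replicate s u₁ ++ map ι₀ xs

      sliced-symmetric : Symmetric Φ → ∀ s → Symmetric (sliced s)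
      sliced-symmetric symmetric s xs a b ys = begin
        sliced s (xs ++ a ∷ b ∷ ys)             ≡⟨ cong Φ (regroup s xs a (b ∷ ys)) ⟩
        Φ (A ++ ι₀ a ∷ ι₀ b ∷ map ι₀ ys)        ≡⟨ symmetric A (ι₀ a) (ι₀ b) (map ι₀ ys) ⟩
        Φ (A ++ ι₀ b ∷ ι₀ a ∷ map ι₀ ys)        ≡⟨ cong Φ (regroup s xs b (a ∷ ys)) ⟨
        sliced s (xs ++ b ∷ a ∷ ys)             ∎
        where
        open ≡-Reasoning
        A = List.replicate s u₁ ++ map ι₀ xs

      module _ (symmetric : Symmetric Φ) where

        private
          move-u₁ : ∀ A xs (Z : List (H p (suc r))) → Φ (A ++ map ι₀ xs ++ u₁ ∷ Z) ≡ Φ (A ++ u₁ ∷ map ι₀ xs ++ Z)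
          move-u₁ A []       Z = refl
          move-u₁ A (x ∷ xs) Z = begin
            Φ (A ++ ι₀ x ∷ map ι₀ xs ++ u₁ ∷ Z)          ≡⟨ cong Φ (Listₚ.++-assoc A (ι₀ x ∷ []) _) ⟨
            Φ ((A ++ ι₀ x ∷ []) ++ map ι₀ xs ++ u₁ ∷ Z)  ≡⟨ move-u₁ (A ++ ι₀ x ∷ []) xs Z ⟩
            Φ ((A ++ ι₀ x ∷ []) ++ u₁ ∷ map ι₀ xs ++ Z)  ≡⟨ cong Φ (Listₚ.++-assoc A (ι₀ x ∷ []) _) ⟩
            Φ (A ++ ι₀ x ∷ u₁ ∷ map ι₀ xs ++ Z)          ≡⟨ symmetric A (ι₀ x) u₁ (map ι₀ xs ++ Z) ⟩
            Φ (A ++ u₁ ∷ ι₀ x ∷ map ι₀ xs ++ Z)          ∎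
            where open ≡-Reasoning

          sort : ∀ gs s xs → Φ (List.replicate s u₁ ++ map ι₀ xs ++ map generator gs) ≡ sliced (s ℕ.+ nothings gs) (xs ++ catMaybes gs)
          sort []             s xs = cong₂ (λ a b → Φ (List.replicate a u₁ ++ b)) (sym (ℕₚ.+-identityʳ s))
            (trans (Listₚ.++-identityʳ (map ι₀ xs)) (cong (map ι₀) (sym (Listₚ.++-identityʳ xs))))
          sort (just h ∷ gs)  s xs = begin
            Φ (List.replicate s u₁ ++ map ι₀ xs ++ ι₀ h ∷ map generator gs)       ≡⟨ cong (λ z → Φ (List.replicate s u₁ ++ z)) snoc ⟩
            Φ (List.replicate s u₁ ++ map ι₀ (xs ++ h ∷ []) ++ map generator gs)  ≡⟨ sort gs s (xs ++ h ∷ []) ⟩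
            sliced (s ℕ.+ nothings gs) ((xs ++ h ∷ []) ++ catMaybes gs)           ≡⟨ cong (sliced (s ℕ.+ nothings gs)) (Listₚ.++-assoc xs (h ∷ []) (catMaybes gs)) ⟩
            sliced (s ℕ.+ nothings gs) (xs ++ h ∷ catMaybes gs)                   ∎
            where
            open ≡-Reasoning
            snoc : map ι₀ xs ++ ι₀ h ∷ map generator gs ≡ map ι₀ (xs ++ h ∷ []) ++ map generator gs
            snoc = trans (sym (Listₚ.++-assoc (map ι₀ xs) (ι₀ h ∷ []) (map generator gs)))
                         (cong (_++ map generator gs) (sym (Listₚ.map-++ ι₀ xs (h ∷ []))))
          sort (nothing ∷ gs) s xs = begin
            Φ (List.replicate s u₁ ++ map ι₀ xs ++ u₁ ∷ map generator gs)    ≡⟨ move-u₁ (List.replicate s u₁) xs (map generator gs) ⟩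
            Φ (List.replicate s u₁ ++ u₁ ∷ map ι₀ xs ++ map generator gs)    ≡⟨ cong Φ (replicate-snoc s) ⟩
            Φ (List.replicate (suc s) u₁ ++ map ι₀ xs ++ map generator gs)   ≡⟨ sort gs (suc s) xs ⟩
            sliced (suc s ℕ.+ nothings gs) (xs ++ catMaybes gs)              ≡⟨ cong (λ i → sliced i (xs ++ catMaybes gs)) (ℕₚ.+-suc s (nothings gs)) ⟨
            sliced (s ℕ.+ suc (nothings gs)) (xs ++ catMaybes gs)            ∎
            where
            open ≡-Reasoning
            replicate-snoc : ∀ s {Z} → List.replicate s u₁ ++ u₁ ∷ Z ≡ List.replicate (suc s) u₁ ++ Z
            replicate-snoc zero    = refl
            replicate-snoc (suc s) = cong (u₁ ∷_) (replicate-snoc s)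

        symmetric-sort : ∀ gs → Φ (map generator gs) ≡ sliced (nothings gs) (catMaybes gs)
        symmetric-sort gs = sort gs 0 []

    extend : F → Hom p r → Hom p (suc r)
    extend t χ = record { fun = extend-fun ; hom = extend-hom }
      where
      extend-fun : H p (suc r) → F
      extend-fun (a ∷ h) = t * a + fun χ h
      extend-hom : ∀ g h → extend-fun (g ⊞ h) ≡ extend-fun g + extend-fun h
      extend-hom (a ∷ g) (b ∷ h) = trans (cong (t * (a + b) +_) (hom χ g h))
        (solve 5 (λ t a b x y → t :* (a :+ b) :+ (x :+ y) := (t :* a :+ x) :+ (t :* b :+ y)) refl t a b (fun χ g) (fun χ h))

    prod-extend : ∀ t χ gs → prod (extend t χ) (map generator gs) ≡ t ^ nothings gs * prod χ (catMaybes gs)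
    prod-extend t χ []             = sym (*-identityˡ 1#)
    prod-extend t χ (nothing ∷ gs) = begin
      (t * 1# + fun χ 0ᴴ) * prod (extend t χ) (map generator gs)    ≡⟨ cong₂ (λ a b → (t * 1# + a) * b) (hom-0ᴴ χ) (prod-extend t χ gs) ⟩
      (t * 1# + 0#) * (t ^ nothings gs * prod χ (catMaybes gs))
        ≡⟨ solve 3 (λ t a b → (t :* con (ℤ.+ 1) :+ con (ℤ.+ 0)) :* (a :* b) := (t :* a) :* b) refl t (t ^ nothings gs) (prod χ (catMaybes gs)) ⟩
      t * t ^ nothings gs * prod χ (catMaybes gs)                   ∎
      where open ≡-Reasoning
    prod-extend t χ (just h ∷ gs)  = begin
      (t * 0# + fun χ h) * prod (extend t χ) (map generator gs)     ≡⟨ cong ((t * 0# + fun χ h) *_) (prod-extend t χ gs) ⟩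
      (t * 0# + fun χ h) * (t ^ nothings gs * prod χ (catMaybes gs))
        ≡⟨ solve 4 (λ t x a b → (t :* con (ℤ.+ 0) :+ x) :* (a :* b) := a :* (x :* b)) refl t (fun χ h) (t ^ nothings gs) (prod χ (catMaybes gs)) ⟩
      t ^ nothings gs * (fun χ h * prod χ (catMaybes gs))           ∎
      where open ≡-Reasoning

  module PrimeCharacteristic (p-prime : Prime p) where

    -- Vandermonde with y = p: every middle term C(p, j) vanishes mod p.
    residue-[n+p]Ck : ∀ n k → k < p → residue ((n ℕ.+ p) C k) ≡ residue (n C k)
    residue-[n+p]Ck n k k<p = begin
      residue ((n ℕ.+ p) C k)
        ≡⟨ vandermonde n p k ⟩
      1# * residue (n C k) + ∑< k (λ j → residue (p C suc j) * residue (n C (k ℕ.∸ suc j)))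
        ≡⟨ cong₂ _+_ (*-identityˡ _) (∑<-zero k (λ j j<k → p∣middle j j<k (residue (n C (k ℕ.∸ suc j))))) ⟩
      residue (n C k) + 0#
        ≡⟨ +-identityʳ _ ⟩
      residue (n C k)
        ∎
      where
      open ≡-Reasoning
      p∣middle : ∀ j → j < k → ∀ w → residue (p C suc j) * w ≡ 0#
      p∣middle j j<k w = trans (cong (_* w) (residue-divisible (prime∣pCk p-prime (s≤s z≤n) (ℕₚ.<-≤-trans (s≤s j<k) k<p)))) (zeroˡ w)

    residue-[n+q*p]Ck : ∀ n q k → k < p → residue ((n ℕ.+ q ℕ.* p) C k) ≡ residue (n C k)
    residue-[n+q*p]Ck n zero    k k<p = cong (λ m → residue (m C k)) (ℕₚ.+-identityʳ n)
    residue-[n+q*p]Ck n (suc q) k k<p = begin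
      residue ((n ℕ.+ (p ℕ.+ q ℕ.* p)) C k)   ≡⟨ cong (λ m → residue (m C k)) (trans (cong (n ℕ.+_) (ℕₚ.+-comm p (q ℕ.* p))) (sym (ℕₚ.+-assoc n (q ℕ.* p) p))) ⟩
      residue ((n ℕ.+ q ℕ.* p ℕ.+ p) C k)     ≡⟨ residue-[n+p]Ck (n ℕ.+ q ℕ.* p) k k<p ⟩
      residue ((n ℕ.+ q ℕ.* p) C k)           ≡⟨ residue-[n+q*p]Ck n q k k<p ⟩
      residue (n C k)                         ∎
      where open ≡-Reasoning

    residue-C-% : ∀ n k → k < p → residue (n C k) ≡ residue ((n % p) C k)
    residue-C-% n k k<p = trans (cong (λ m → residue (m C k)) (m≡m%n+[m/n]*n n p)) (residue-[n+q*p]Ck (n % p) (n / p) k k<p)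

    binom-+ : ∀ a b m → m < p → binom (a + b) m ≡ ∑< (suc m) (λ j → binom b j * binom a (m ℕ.∸ j))
    binom-+ a b m m<p = begin
      residue (toℕ (a + b) C m)                   ≡⟨ cong (λ n → residue (n C m)) (toℕ-residue (toℕ a ℕ.+ toℕ b)) ⟩
      residue (((toℕ a ℕ.+ toℕ b) % p) C m)       ≡⟨ residue-C-% (toℕ a ℕ.+ toℕ b) m m<p ⟨
      residue ((toℕ a ℕ.+ toℕ b) C m)             ≡⟨ vandermonde (toℕ a) (toℕ b) m ⟩
      ∑< (suc m) (λ j → binom b j * binom a (m ℕ.∸ j)) ∎
      where open ≡-Reasoning

    p[]-Δ : ∀ {r} (χ : Hom p r) m (g : H p r) y → m < p →
            p[ χ , m ] (Δ g y) ≡ ∑< m (λ j → binom (fun χ g) (suc j) * p[ χ , m ℕ.∸ suc j ] y)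
    p[]-Δ {r} χ m g y m<p = begin
      ∑H r (λ h → Δ g y h * B m h)
        ≡⟨ ∑-cong (allH p r) (λ h → trans (cong (_* B m h) (Δ-apply g y h)) (solve 3 (λ a b c → (a :- b) :* c := a :* c :+ (:- (b :* c))) refl (y (h ⊟ g)) (y h) (B m h))) ⟩
      ∑H r (λ h → y (h ⊟ g) * B m h - y h * B m h)
        ≡⟨ ∑-+ (allH p r) _ _ ⟩
      ∑H r (λ h → y (h ⊟ g) * B m h) + ∑H r (λ h → - (y h * B m h))
        ≡⟨ cong₂ _+_ (∑H-translate r g y (B m)) (∑-neg (allH p r) (λ h → y h * B m h)) ⟩
      ∑H r (λ k → y k * B m (k ⊞ g)) - p[ χ , m ] y
        ≡⟨ cong (_- p[ χ , m ] y) (trans (∑-cong (allH p r) shifted) (∑-+ (allH p r) _ _)) ⟩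
      (p[ χ , m ] y + ∑H r (λ k → ∑< m (λ j → c j * (y k * B (m ℕ.∸ suc j) k)))) - p[ χ , m ] y
        ≡⟨ cong (λ z → (p[ χ , m ] y + z) - p[ χ , m ] y) (trans (∑-∑<-comm (allH p r) m _) (∑<-cong m (λ j _ → ∑-*ˡ (allH p r) (c j) _))) ⟩
      (p[ χ , m ] y + ∑< m (λ j → c j * p[ χ , m ℕ.∸ suc j ] y)) - p[ χ , m ] y
        ≡⟨ solve 2 (λ a b → (a :+ b) :- a := b) refl (p[ χ , m ] y) (∑< m (λ j → c j * p[ χ , m ℕ.∸ suc j ] y)) ⟩
      ∑< m (λ j → c j * p[ χ , m ℕ.∸ suc j ] y)
        ∎
      where
      open ≡-Reasoning
      B : ℕ → H p r → F
      B m h = binom (fun χ h) m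
      c : ℕ → F
      c j = binom (fun χ g) (suc j)
      shifted : ∀ k → y k * B m (k ⊞ g) ≡ y k * B m k + ∑< m (λ j → c j * (y k * B (m ℕ.∸ suc j) k))
      shifted k = begin
        y k * binom (fun χ (k ⊞ g)) m
          ≡⟨ cong (λ a → y k * binom a m) (hom χ k g) ⟩
        y k * binom (fun χ k + fun χ g) m
          ≡⟨ cong (y k *_) (binom-+ (fun χ k) (fun χ g) m m<p) ⟩
        y k * (1# * B m k + ∑< m (λ j → c j * B (m ℕ.∸ suc j) k))
          ≡⟨ trans (*-distribˡ-+ (y k) _ _) (cong (_+ y k * ∑< m (λ j → c j * B (m ℕ.∸ suc j) k)) (cong (y k *_) (*-identityˡ (B m k)))) ⟩
        y k * B m k + y k * ∑< m (λ j → c j * B (m ℕ.∸ suc j) k)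
          ≡⟨ cong (y k * B m k +_) (trans (sym (∑<-*ˡ m (y k) _)) (∑<-cong m (λ j _ → solve 3 (λ a b d → a :* (b :* d) := b :* (a :* d)) refl (y k) (c j) (B (m ℕ.∸ suc j) k)))) ⟩
        y k * B m k + ∑< m (λ j → c j * (y k * B (m ℕ.∸ suc j) k))
          ∎

    Vanishes : ∀ {r} → Hom p r → ℕ → Set
    Vanishes χ m = m < p → ∀ {x} → x ∈I^ suc m → p[ χ , m ] x ≡ 0#

    lower-terms-vanish : ∀ {r} (χ : Hom p r) k → (∀ m → m < k → Vanishes χ m) → k < p →
                         ∀ {y} → y ∈I^ k → ∀ j → j < k → p[ χ , k ℕ.∸ suc j ] y ≡ 0#
    lower-terms-vanish χ (suc k) ih k<p y∈I^k j j<k =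
      ih (k ℕ.∸ j) (s≤s (ℕₚ.m∸n≤m k j)) (ℕₚ.≤-<-trans (ℕₚ.m∸n≤m k j) (ℕₚ.<-trans (ℕₚ.n<1+n k) k<p))
         (∈I^-≤ (s≤s (ℕₚ.m∸n≤m k j)) y∈I^k)

    p[]-vanishes : ∀ {r} (χ : Hom p r) m → Vanishes χ m
    p[]-vanishes {r} χ = <-rec (Vanishes χ) step
      where
      step : ∀ m → (∀ {k} → k < m → Vanishes χ k) → Vanishes χ m
      step m ih m<p (pow-gen a y a∈I y∈I^m) = begin
        p[ χ , m ] (a ⋆ y)                  ≡⟨ p[]-⋆ χ m a y a∈I ⟩
        ∑H r (λ g → a g * p[ χ , m ] (Δ g y)) ≡⟨ ∑-zero (allH p r) (λ g → trans (cong (a g *_) (Δ-term g)) (zeroʳ (a g))) ⟩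
        0#                                  ∎
        where
        open ≡-Reasoning
        Δ-term : ∀ g → p[ χ , m ] (Δ g y) ≡ 0#
        Δ-term g = trans (p[]-Δ χ m g y m<p) (∑<-zero m (λ j j<m → trans
          (cong (binom (fun χ g) (suc j) *_) (lower-terms-vanish χ m (λ k k<m → ih k<m) m<p y∈I^m j j<m)) (zeroʳ (binom (fun χ g) (suc j)))))
      step m ih m<p pow-0 = p[]-0 χ m
      step m ih m<p (pow-add {x = x} {y = y} d e) =
        trans (p[]-⊕ χ m x y) (trans (cong₂ _+_ (step m ih m<p d) (step m ih m<p e)) (+-identityʳ 0#))
      step m ih m<p (pow-scal {x = x} c d) =
        trans (p[]-· χ m c x) (trans (cong (c *_) (step m ih m<p d)) (zeroʳ c))

    p[]-Δ-top : ∀ {r} (χ : Hom p r) k (g : H p r) {y} → y ∈I^ k → suc k < p →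
                p[ χ , suc k ] (Δ g y) ≡ fun χ g * p[ χ , k ] y
    p[]-Δ-top χ k g {y} y∈I^k k<p = begin
      p[ χ , suc k ] (Δ g y)
        ≡⟨ p[]-Δ χ (suc k) g y k<p ⟩
      binom (fun χ g) 1 * p[ χ , k ] y + ∑< k (λ j → binom (fun χ g) (suc (suc j)) * p[ χ , k ℕ.∸ suc j ] y)
        ≡⟨ cong₂ _+_ (cong (_* p[ χ , k ] y) (binom-1 (fun χ g)))
                     (∑<-zero k (λ j j<k → trans (cong (binom (fun χ g) (suc (suc j)) *_) (lower-terms-vanish χ k (λ m _ → p[]-vanishes χ m) (ℕₚ.<-trans (ℕₚ.n<1+n k) k<p) y∈I^k j j<k)) (zeroʳ (binom (fun χ g) (suc (suc j)))))) ⟩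
      fun χ g * p[ χ , k ] y + 0#
        ≡⟨ +-identityʳ _ ⟩
      fun χ g * p[ χ , k ] y
        ∎
      where open ≡-Reasoning

    p[]-Δs : ∀ {r} (χ : Hom p r) (hs : List (H p r)) k {y} → y ∈I^ k → List.length hs ℕ.+ k < p →
             p[ χ , List.length hs ℕ.+ k ] (Δs hs y) ≡ prod χ hs * p[ χ , k ] y
    p[]-Δs χ []       k y∈I^k k<p = sym (*-identityˡ _)
    p[]-Δs χ (h ∷ hs) k {y} y∈I^k bound = begin
      p[ χ , suc (List.length hs ℕ.+ k) ] (Δs hs (Δ h y))
        ≡⟨ cong (λ i → p[ χ , i ] (Δs hs (Δ h y))) (ℕₚ.+-suc (List.length hs) k) ⟨
      p[ χ , List.length hs ℕ.+ suc k ] (Δs hs (Δ h y))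
        ≡⟨ p[]-Δs χ hs (suc k) (Δ-∈I^ h y∈I^k) (subst (_< p) (sym (ℕₚ.+-suc (List.length hs) k)) bound) ⟩
      prod χ hs * p[ χ , suc k ] (Δ h y)
        ≡⟨ cong (prod χ hs *_) (p[]-Δ-top χ k h y∈I^k (ℕₚ.≤-<-trans (s≤s (ℕₚ.m≤n+m k (List.length hs))) bound)) ⟩
      prod χ hs * (fun χ h * p[ χ , k ] y)
        ≡⟨ solve 3 (λ a b c → a :* (b :* c) := (b :* a) :* c) refl (prod χ hs) (fun χ h) (p[ χ , k ] y) ⟩
      (fun χ h * prod χ hs) * p[ χ , k ] y
        ∎
      where open ≡-Reasoning

    p[]-Δs-[0] : ∀ {r} (χ : Hom p r) (hs : List (H p r)) → List.length hs < p →
                 p[ χ , List.length hs ] (Δs hs [ 0ᴴ ]) ≡ prod χ hs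
    p[]-Δs-[0] χ hs bound = begin
      p[ χ , List.length hs ] (Δs hs [ 0ᴴ ])
        ≡⟨ cong (λ i → p[ χ , i ] (Δs hs [ 0ᴴ ])) (ℕₚ.+-identityʳ (List.length hs)) ⟨
      p[ χ , List.length hs ℕ.+ 0 ] (Δs hs [ 0ᴴ ])
        ≡⟨ p[]-Δs χ hs 0 (pow-zero _) (subst (_< p) (sym (ℕₚ.+-identityʳ (List.length hs))) bound) ⟩
      prod χ hs * p[ χ , 0 ] [ 0ᴴ ]
        ≡⟨ trans (cong (prod χ hs *_) (p[]-[0] χ)) (*-identityʳ _) ⟩
      prod χ hs
        ∎
      where open ≡-Reasoning

    module _ {r : ℕ} (n : ℕ) where

      linComb-∑ : ∀ L x → linComb p r n L x ≡ ∑ L (λ cχ → proj₁ cχ * p[ proj₂ cχ , n ] x)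
      linComb-∑ []             x = refl
      linComb-∑ ((c , χ) ∷ L) x = cong₂ _+_ (cong (c *_) (pχ≡p[] n χ x)) (linComb-∑ L x)

      linComb-cong : ∀ L {x y} → x ≗ y → linComb p r n L x ≡ linComb p r n L y
      linComb-cong L {x} {y} eq = begin
        linComb p r n L x                                ≡⟨ linComb-∑ L x ⟩
        ∑ L (λ cχ → proj₁ cχ * p[ proj₂ cχ , n ] x)      ≡⟨ ∑-cong L (λ cχ → cong (proj₁ cχ *_) (p[]-cong (proj₂ cχ) n eq)) ⟩
        ∑ L (λ cχ → proj₁ cχ * p[ proj₂ cχ , n ] y)      ≡⟨ linComb-∑ L y ⟨
        linComb p r n L y                                ∎
        where open ≡-Reasoning

      linComb-⊕ : ∀ L x y → linComb p r n L (x ⊕ y) ≡ linComb p r n L x + linComb p r n L y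
      linComb-⊕ L x y = begin
        linComb p r n L (x ⊕ y)
          ≡⟨ linComb-∑ L (x ⊕ y) ⟩
        ∑ L (λ cχ → proj₁ cχ * p[ proj₂ cχ , n ] (x ⊕ y))
          ≡⟨ ∑-cong L (λ cχ → trans (cong (proj₁ cχ *_) (p[]-⊕ (proj₂ cχ) n x y)) (*-distribˡ-+ (proj₁ cχ) _ _)) ⟩
        ∑ L (λ cχ → proj₁ cχ * p[ proj₂ cχ , n ] x + proj₁ cχ * p[ proj₂ cχ , n ] y)
          ≡⟨ ∑-+ L _ _ ⟩
        ∑ L (λ cχ → proj₁ cχ * p[ proj₂ cχ , n ] x) + ∑ L (λ cχ → proj₁ cχ * p[ proj₂ cχ , n ] y)
          ≡⟨ cong₂ _+_ (linComb-∑ L x) (linComb-∑ L y) ⟨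
        linComb p r n L x + linComb p r n L y
          ∎
        where open ≡-Reasoning

      linComb-· : ∀ L c x → linComb p r n L (c · x) ≡ c * linComb p r n L x
      linComb-· L c x = begin
        linComb p r n L (c · x)
          ≡⟨ linComb-∑ L (c · x) ⟩
        ∑ L (λ cχ → proj₁ cχ * p[ proj₂ cχ , n ] (c · x))
          ≡⟨ ∑-cong L (λ cχ → trans (cong (proj₁ cχ *_) (p[]-· (proj₂ cχ) n c x))
                                     (solve 3 (λ a b d → a :* (b :* d) := b :* (a :* d)) refl (proj₁ cχ) c (p[ proj₂ cχ , n ] x))) ⟩
        ∑ L (λ cχ → c * (proj₁ cχ * p[ proj₂ cχ , n ] x))
          ≡⟨ ∑-*ˡ L c _ ⟩
        c * ∑ L (λ cχ → proj₁ cχ * p[ proj₂ cχ , n ] x)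
          ≡⟨ cong (c *_) (linComb-∑ L x) ⟨
        c * linComb p r n L x
          ∎
        where open ≡-Reasoning

      linComb-vanishes : ∀ L → n < p → ∀ {x} → x ∈I^ suc n → linComb p r n L x ≡ 0#
      linComb-vanishes L n<p {x} d = trans (linComb-∑ L x)
        (∑-zero L (λ cχ → trans (cong (proj₁ cχ *_) (p[]-vanishes (proj₂ cχ) n n<p d)) (zeroʳ (proj₁ cχ))))

      linComb-Δs-[0] : ∀ L hs → List.length hs ≡ n → n < p → linComb p r n L (Δs hs [ 0ᴴ ]) ≡ combination L hs
      linComb-Δs-[0] L hs refl n<p = trans (linComb-∑ L (Δs hs [ 0ᴴ ]))
        (∑-cong L (λ cχ → cong (proj₁ cχ *_) (p[]-Δs-[0] (proj₂ cχ) hs n<p)))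

      linCombᴰ : n < p → List (F × Hom p r) → DualGraded p r n
      linCombᴰ n<p L = record
        { φ        = linComb p r n L
        ; resp     = λ _ → linComb-cong L
        ; additive = λ {x} {y} _ _ → linComb-⊕ L x y
        ; homog    = λ {x} c _ → linComb-· L c x
        ; vanish   = linComb-vanishes L n<p
        }

    -- Interpolation

    residue-invertible : ∀ m → 0 < m → m < p → Σ F (λ i → i * residue m ≡ 1#)
    residue-invertible m@(suc _) _ m<p with coprime-Bézout (Coprimality.sym (prime⇒coprime p-prime m<p))
    ... | Bézout.+- x y eq = residue x , (begin
      residue x * residue m       ≡⟨ residue-* x m ⟨
      residue (x ℕ.* m)           ≡⟨ cong residue eq ⟨
      residue (1 ℕ.+ y ℕ.* p)     ≡⟨ residue-+ 1 (y ℕ.* p) ⟩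
      1# + residue (y ℕ.* p)      ≡⟨ cong (1# +_) (residue-divisible (divides y refl)) ⟩
      1# + 0#                     ≡⟨ +-identityʳ 1# ⟩
      1#                          ∎)
      where open ≡-Reasoning
    ... | Bézout.-+ x y eq = - residue x , (begin
      - residue x * residue m     ≡⟨ -‿distribˡ-* (residue x) (residue m) ⟨
      - (residue x * residue m)   ≡⟨ cong -_ (residue-* x m) ⟨
      - residue (x ℕ.* m)         ≡⟨ cong -_ (+-inverseʳ-unique 1# (residue (x ℕ.* m)) 1+xm≡0) ⟩
      - - 1#                      ≡⟨ -‿involutive 1# ⟩
      1#                          ∎)
      where
      open ≡-Reasoning
      1+xm≡0 : 1# + residue (x ℕ.* m) ≡ 0#
      1+xm≡0 = trans (sym (residue-+ 1 (x ℕ.* m))) (trans (cong residue eq) (residue-divisible (divides y refl)))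

    -- Junk value 0# outside 1 ≤ m < p.
    inv : ℕ → F
    inv zero = 0#
    inv m@(suc _) with m ℕ.<? p
    ... | yes m<p = proj₁ (residue-invertible m (s≤s z≤n) m<p)
    ... | no _    = 0#

    inv-* : ∀ m → 0 < m → m < p → inv m * residue m ≡ 1#
    inv-* m@(suc _) _ m<p with m ℕ.<? p
    ... | yes m<p′ = proj₂ (residue-invertible m (s≤s z≤n) m<p′)
    ... | no m≮p   = ⊥-elim (m≮p m<p)

    -- If A has moments δ_{n,j} for j ≤ n then, by the binomial theorem, (shift A - A)/(n+1)
    -- has moments δ_{n+1,k} for k ≤ n + 1.
    raise : ℕ → Weights → Weights
    raise n A = scale (inv (suc n)) (shift A ++ scale (- 1#) A)

    weights : ℕ → ℕ → Weights
    weights zero    s = (1# , 0#) ∷ []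
    weights (suc n) s with s ℕ.≟ suc n
    ... | yes _ = raise n (weights n n)
    ... | no _  = weights n s ++ scale (- moment (weights n s) (suc n)) (raise n (weights n n))

    Isolates : ℕ → ℕ → Weights → Set
    Isolates n s A = ∀ k → k ≤ n → moment A k ≡ select (s ℕ.≟ k) 1#

    raise-isolates : ∀ n A → suc n < p → Isolates n n A → Isolates (suc n) (suc n) (raise n A)
    raise-isolates n A n<p isolates k k≤1+n = begin
      moment (raise n A) k
        ≡⟨ moment-scale (inv (suc n)) (shift A ++ scale (- 1#) A) k ⟩
      inv (suc n) * moment (shift A ++ scale (- 1#) A) k
        ≡⟨ cong (inv (suc n) *_) (moment-difference A k) ⟩
      inv (suc n) * ∑< k (λ j → residue (k C j) * moment A j)
        ≡⟨ cong (inv (suc n) *_) (∑<-cong k (λ j j<k → trans (cong (residue (k C j) *_) (isolates j (ℕₚ.≤-pred (ℕₚ.≤-trans j<k k≤1+n))))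
                                         (trans (select-*ˡ (n ℕ.≟ j) (residue (k C j)) 1#) (trans (select-⇔ (n ℕ.≟ j) (j ℕ.≟ n) sym sym) (cong (select (j ℕ.≟ n)) (*-identityʳ (residue (k C j)))))))) ⟩
      inv (suc n) * ∑< k (λ j → select (j ℕ.≟ n) (residue (k C j)))
        ≡⟨ top (ℕₚ.m≤n⇒m<n∨m≡n k≤1+n) ⟩
      select (suc n ℕ.≟ k) 1#
        ∎
      where
      open ≡-Reasoning
      top : k < suc n ⊎ k ≡ suc n → inv (suc n) * ∑< k (λ j → select (j ℕ.≟ n) (residue (k C j))) ≡ select (suc n ℕ.≟ k) 1#
      top (inj₁ (s≤s k≤n)) = trans (cong (inv (suc n) *_) (∑<-δ-beyond k n (λ j → residue (k C j)) k≤n))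
        (trans (zeroʳ (inv (suc n))) (sym (select-no (suc n ℕ.≟ k) (λ { refl → ℕₚ.<-irrefl refl (s≤s k≤n) }))))
      top (inj₂ refl) = begin
        inv (suc n) * ∑< (suc n) (λ j → select (j ℕ.≟ n) (residue (suc n C j)))
          ≡⟨ cong (inv (suc n) *_) (∑<-δ (suc n) n (λ j → residue (suc n C j)) ℕₚ.≤-refl) ⟩
        inv (suc n) * residue (suc n C n)
          ≡⟨ cong (λ m → inv (suc n) * residue m) (trans (nCk≡nC[n∸k] (ℕₚ.n≤1+n n)) (trans (cong (suc n C_) (ℕₚ.m+n∸n≡m 1 n)) (nC1≡n (suc n)))) ⟩
        inv (suc n) * residue (suc n)
          ≡⟨ inv-* (suc n) (s≤s z≤n) n<p ⟩
        1#
          ≡⟨ select-yes (suc n ℕ.≟ suc n) refl ⟨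
        select (suc n ℕ.≟ suc n) 1#
          ∎

    weights-isolates : ∀ n → n < p → ∀ s → s ≤ n → Isolates n s (weights n s)
    weights-isolates zero    _   zero    _ zero    _ = trans (+-identityʳ _) (*-identityˡ 1#)
    weights-isolates (suc n) n<p s s≤1+n k k≤1+n with s ℕ.≟ suc n
    ... | yes refl = raise-isolates n (weights n n) n<p (weights-isolates n n<p′ n ℕₚ.≤-refl) k k≤1+n
      where n<p′ = ℕₚ.<-trans (ℕₚ.n<1+n n) n<p
    ... | no s≢1+n = begin
      moment (weights n s ++ scale (- α) top) k           ≡⟨ ∑-++ (weights n s) (scale (- α) top) _ ⟩
      moment (weights n s) k + moment (scale (- α) top) k ≡⟨ cong (moment (weights n s) k +_) (trans (moment-scale (- α) top k) (cong (- α *_) (top-isolates k k≤1+n))) ⟩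
      moment (weights n s) k + - α * select (suc n ℕ.≟ k) 1#
        ≡⟨ corrected (ℕₚ.m≤n⇒m<n∨m≡n k≤1+n) ⟩
      select (s ℕ.≟ k) 1#                                  ∎
      where
      open ≡-Reasoning
      n<p′ = ℕₚ.<-trans (ℕₚ.n<1+n n) n<p
      s≤n : s ≤ n
      s≤n = ℕₚ.≤-pred (ℕₚ.≤∧≢⇒< s≤1+n s≢1+n)
      top : Weights
      top = raise n (weights n n)
      top-isolates : Isolates (suc n) (suc n) top
      top-isolates = raise-isolates n (weights n n) n<p (weights-isolates n n<p′ n ℕₚ.≤-refl)
      α : F
      α = moment (weights n s) (suc n)
      corrected : k < suc n ⊎ k ≡ suc n → moment (weights n s) k + - α * select (suc n ℕ.≟ k) 1# ≡ select (s ℕ.≟ k) 1#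
      corrected (inj₁ (s≤s k≤n)) = begin
        moment (weights n s) k + - α * select (suc n ℕ.≟ k) 1#
          ≡⟨ cong₂ _+_ (weights-isolates n n<p′ s s≤n k k≤n) (cong (- α *_) (select-no (suc n ℕ.≟ k) (λ { refl → ℕₚ.<-irrefl refl (s≤s k≤n) }))) ⟩
        select (s ℕ.≟ k) 1# + - α * 0#
          ≡⟨ trans (cong (select (s ℕ.≟ k) 1# +_) (zeroʳ (- α))) (+-identityʳ _) ⟩
        select (s ℕ.≟ k) 1#
          ∎
      corrected (inj₂ refl) = begin
        α + - α * select (suc n ℕ.≟ suc n) 1#
          ≡⟨ cong (λ z → α + - α * z) (select-yes (suc n ℕ.≟ suc n) refl) ⟩
        α + - α * 1#
          ≡⟨ trans (cong (α +_) (*-identityʳ (- α))) (-‿inverseʳ α) ⟩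
        0#
          ≡⟨ select-no (s ℕ.≟ suc n) s≢1+n ⟨
        select (s ℕ.≟ suc n) 1#
          ∎

    module _ {r : ℕ} where
      open FirstCoordinate {r}

      extensions : ℕ → ℕ → F × Hom p r → List (F × Hom p (suc r))
      extensions n s cχ = map (λ wt → proj₁ cχ * proj₁ wt , extend (proj₂ wt) (proj₂ cχ)) (weights n s)

      -- On a list containing K copies of u₁, the weights of `extensions n s` cancel unless s = K.
      interpolate : ℕ → (ℕ → List (F × Hom p r)) → List (F × Hom p (suc r))
      interpolate n Ls = concatMap (λ s → concatMap (extensions n s) (Ls s)) (upTo (suc n))

      combination-interpolate : ∀ n Ls gs → n < p → nothings gs ≤ n →
                                combination (interpolate n Ls) (map generator gs) ≡ combination (Ls (nothings gs)) (catMaybes gs)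
      combination-interpolate n Ls gs n<p K≤n = begin
        combination (interpolate n Ls) G
          ≡⟨ ∑-concatMap (upTo (suc n)) (λ s → concatMap (term s) (Ls s)) value ⟩
        ∑ (upTo (suc n)) (λ s → ∑ (concatMap (term s) (Ls s)) value)
          ≡⟨ ∑-applyUpTo (suc n) (λ s → s) _ ⟩
        ∑< (suc n) (λ s → ∑ (concatMap (term s) (Ls s)) value)
          ≡⟨ ∑<-cong (suc n) (λ s s<1+n → trans (∑-concatMap (Ls s) (term s) value) (∑-cong (Ls s) (slice s s<1+n))) ⟩
        ∑< (suc n) (λ s → ∑ (Ls s) (λ cχ → proj₁ cχ * prod (proj₂ cχ) J * select (s ℕ.≟ K) 1#))
          ≡⟨ ∑<-cong (suc n) (λ s _ → trans (∑-*ʳ (Ls s) (select (s ℕ.≟ K) 1#) (λ cχ → proj₁ cχ * prod (proj₂ cχ) J))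
                                            (trans (select-*ˡ (s ℕ.≟ K) (combination (Ls s) J) 1#) (cong (select (s ℕ.≟ K)) (*-identityʳ (combination (Ls s) J))))) ⟩
        ∑< (suc n) (λ s → select (s ℕ.≟ K) (combination (Ls s) J))
          ≡⟨ ∑<-δ (suc n) K (λ s → combination (Ls s) J) (s≤s K≤n) ⟩
        combination (Ls K) J
          ∎
        where
        open ≡-Reasoning
        G = map generator gs
        K = nothings gs
        J = catMaybes gs
        term = extensions n
        value : F × Hom p (suc r) → F
        value cχ = proj₁ cχ * prod (proj₂ cχ) G
        slice : ∀ s → s < suc n → (cχ : F × Hom p r) → ∑ (term s cχ) value ≡ proj₁ cχ * prod (proj₂ cχ) J * select (s ℕ.≟ K) 1#
        slice s (s≤s s≤n) (c , χ) = begin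
          ∑ (term s (c , χ)) value
            ≡⟨ ∑-map (weights n s) _ value ⟩
          ∑ (weights n s) (λ wt → (c * proj₁ wt) * prod (extend (proj₂ wt) χ) G)
            ≡⟨ ∑-cong (weights n s) (λ wt → trans (cong ((c * proj₁ wt) *_) (prod-extend (proj₂ wt) χ gs))
                 (solve 4 (λ c w a b → (c :* w) :* (a :* b) := (c :* b) :* (w :* a)) refl c (proj₁ wt) (proj₂ wt ^ K) (prod χ J))) ⟩
          ∑ (weights n s) (λ wt → (c * prod χ J) * (proj₁ wt * proj₂ wt ^ K))
            ≡⟨ ∑-*ˡ (weights n s) (c * prod χ J) _ ⟩
          c * prod χ J * moment (weights n s) K
            ≡⟨ cong (c * prod χ J *_) (weights-isolates n n<p s s≤n K K≤n) ⟩
          c * prod χ J * select (s ℕ.≟ K) 1#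
            ∎

    trivialCharacter : Hom p 0
    trivialCharacter = record { fun = λ _ → 0# ; hom = λ _ _ → sym (+-identityʳ 0#) }

    symmetric-multiadditive⇒combination :
      ∀ r n → n < p → (Φ : List (H p r) → F) → Multiadditive Φ → Symmetric Φ →
      Σ (List (F × Hom p r)) (λ L → ∀ hs → List.length hs ≡ n → Φ hs ≡ combination L hs)
    symmetric-multiadditive⇒combination zero zero _ Φ _ _ =
      (Φ [] , trivialCharacter) ∷ [] , λ { [] refl → sym (trans (+-identityʳ _) (*-identityʳ _)) }
    symmetric-multiadditive⇒combination zero (suc n) _ Φ additive _ =
      [] , λ { ([] ∷ hs) _ → x+x≈x⇒x≈0 _ (sym (additive [] hs [] [])) }
    symmetric-multiadditive⇒combination (suc r) n n<p Φ additive symmetric =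
      L , multiadditive-ext n Φ (combination L) additive (combination-multiadditive L) on-generators
      where
      open FirstCoordinate {r}
      slice : ∀ s → Σ (List (F × Hom p r)) (λ L → ∀ hs → List.length hs ≡ n ℕ.∸ s → sliced Φ s hs ≡ combination L hs)
      slice s = symmetric-multiadditive⇒combination r (n ℕ.∸ s) (ℕₚ.≤-<-trans (ℕₚ.m∸n≤m n s) n<p)
                  (sliced Φ s) (sliced-multiadditive Φ additive s) (sliced-symmetric Φ symmetric s)
      L : List (F × Hom p (suc r))
      L = interpolate n (λ s → proj₁ (slice s))
      on-generators : ∀ gs → List.length gs ≡ n → Φ (map generator gs) ≡ combination L (map generator gs)
      on-generators gs |gs|≡n = begin
        Φ (map generator gs)                                   ≡⟨ symmetric-sort Φ symmetric gs ⟩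
        sliced Φ (nothings gs) (catMaybes gs)                  ≡⟨ proj₂ (slice (nothings gs)) (catMaybes gs) |J|≡n-K ⟩
        combination (proj₁ (slice (nothings gs))) (catMaybes gs) ≡⟨ combination-interpolate n (λ s → proj₁ (slice s)) gs n<p K≤n ⟨
        combination L (map generator gs)                       ∎
        where
        open ≡-Reasoning
        split-length : nothings gs ℕ.+ List.length (catMaybes gs) ≡ n
        split-length = trans (sym (length≡nothings+catMaybes gs)) |gs|≡n
        K≤n : nothings gs ≤ n
        K≤n = subst (nothings gs ≤_) split-length (ℕₚ.m≤m+n _ _)
        |J|≡n-K : List.length (catMaybes gs) ≡ n ℕ.∸ nothings gs
        |J|≡n-K = trans (sym (ℕₚ.m+n∸m≡n (nothings gs) _)) (cong (ℕ._∸ nothings gs) split-length)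

lemma4p12 : (p : ℕ) .{{nz : NonZero p}} → Prime p → (r n : ℕ) → 1 ≤ r → 1 ≤ n → n < p →
    (ψ : DualGraded p r n) →
    Σ (List (Fp p × Hom p r)) (λ L →
      ∀ x → InIPow p r n x → φ ψ x ≡ linComb p r n L x)
lemma4p12 p p-prime r n _ _ n<p ψ = L , λ x → DualGraded-ext ψ (linCombᴰ n n<p L) agree
  where
  open Theory p
  open PrimeCharacteristic p-prime
  open DualGradedProperties ψ
  Φ : List (H p r) → F
  Φ = extendByZero n monomial
  Φ-combination : Σ (List (F × Hom p r)) (λ L → ∀ hs → List.length hs ≡ n → Φ hs ≡ combination L hs)
  Φ-combination = symmetric-multiadditive⇒combination r n n<p Φ
                    (extendByZero-multiadditive n monomial monomial-multiadditive)
                    (extendByZero-symmetric n monomial monomial-symmetric)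
  L : List (F × Hom p r)
  L = proj₁ Φ-combination
  agree : ∀ hs → List.length hs ≡ n → monomial hs ≡ linComb p r n L (Δs hs [ 0ᴴ ])
  agree hs |hs|≡n = begin
    monomial hs                          ≡⟨ extendByZero-≡ n monomial hs |hs|≡n ⟨
    Φ hs                                 ≡⟨ proj₂ Φ-combination hs |hs|≡n ⟩
    combination L hs                     ≡⟨ linComb-Δs-[0] n L hs |hs|≡n n<p ⟨
    linComb p r n L (Δs hs [ 0ᴴ ])       ∎
    where open ≡-Reasoning
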